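{- Let $A\in\mathbb{Z}^{m\times n}$, $b\in\mathbb{Z}^m$, $\Delta$ the largest absolute value of an entry of $A$, $\mathcal{P}=\{x\in\mathbb{R}^n_{\ge0}: Ax=b\}$ and $\mathcal{P}_I=\operatorname{Conv}(\mathcal{P}\cap\mathbb{Z}^n)$. For each vertex $v$ of $\mathcal{P}_I$ with $|\operatorname{supp}(v)|=s$ we have $s\le 2m\log(24\sqrt{m}\Delta)$.
   Context: All logarithms are base 2. $\operatorname{supp}(v)=\{i: v_i\neq 0\}$. A vertex of $\mathcal{P}_I$ is a point $v\in\mathcal{P}_I$ with $v\notin\operatorname{Conv}(\mathcal{P}_I\setminus\{v\})$.
   Formalization: The points of $\mathcal{P}$ and $\mathcal{P}_I$, including the vertex $v$, lie in ℚ^n rather than ℝ^n, and convex combinations have rational weights. -}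

module Defs where

open import Data.Nat using (ℕ; zero; suc; _⊔_) renaming (_+_ to _+ℕ_)
open import Data.Fin using (Fin; zero; suc)
open import Data.Integer using (ℤ; ∣_∣)
open import Data.Rational using (ℚ; 0ℚ; 1ℚ; _+_; _*_; _≤_; _/_)
open import Data.Rational.Properties using (_≟_)
open import Data.Product using (Σ; ∃; _×_)
open import Relation.Binary.PropositionalEquality using (_≡_)
open import Relation.Nullary using (¬_; yes; no)

Matrix : ℕ → ℕ → Set
Matrix m n = Fin m → Fin n → ℤ

Vect : ℕ → Set
Vect n = Fin n → ℚ

ι : ℤ → ℚ
ι z = z / 1

sumℚ : ∀ {k} → (Fin k → ℚ) → ℚ
sumℚ {zero} f = 0ℚ
sumℚ {suc k} f = f zero + sumℚ (λ i → f (suc i))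

maxℕ : ∀ {k} → (Fin k → ℕ) → ℕ
maxℕ {zero} f = 0
maxℕ {suc k} f = f zero ⊔ maxℕ (λ i → f (suc i))

Δ : ∀ {m n} → Matrix m n → ℕ
Δ A = maxℕ (λ i → maxℕ (λ j → ∣ A i j ∣))

InP : ∀ {m n} → Matrix m n → (Fin m → ℤ) → Vect n → Set
InP A b x = (∀ j → 0ℚ ≤ x j) × (∀ i → sumℚ (λ j → ι (A i j) * x j) ≡ ι (b i))

IsIntegral : ∀ {n} → Vect n → Set
IsIntegral x = ∀ j → ∃ λ (z : ℤ) → x j ≡ ι z

InConv : ∀ {n} → (Vect n → Set) → Vect n → Set
InConv {n} S x =
  Σ ℕ λ k → Σ (Fin k → Vect n) λ p → Σ (Fin k → ℚ) λ w →
    (∀ l → 0ℚ ≤ w l) × (sumℚ w ≡ 1ℚ) × (∀ l → S (p l)) ×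
    (∀ j → x j ≡ sumℚ (λ l → w l * p l j))

InPI : ∀ {m n} → Matrix m n → (Fin m → ℤ) → Vect n → Set
InPI A b = InConv (λ y → InP A b y × IsIntegral y)

IsVertex : ∀ {m n} → Matrix m n → (Fin m → ℤ) → Vect n → Set
IsVertex A b v = InPI A b v × ¬ InConv (λ y → InPI A b y × ¬ (∀ j → y j ≡ v j)) v

suppSize : ∀ {n} → Vect n → ℕ
suppSize {zero} v = 0
suppSize {suc n} v with v zero ≟ 0ℚ
... | yes _ = suppSize (λ j → v (suc j))
... | no _ = suc (suppSize (λ j → v (suc j)))

module Submission where

-- Corollary 14: if v is a vertex of P_I = Conv(P ∩ ℤⁿ), P = {x ≥ 0 : A x = b}, with s = |supp v|
-- and Δ ≥ 1, then 2^s ≤ (576 m Δ²)^m, i.e. s ≤ m log(576 m Δ²) = 2m log(24 √m Δ).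
--
-- A vertex v of P_I is an integral point V of P, and no nonzero Z ∈ {0, ±1}ⁿ supported in
-- supp v has A Z = 0, since otherwise v = ½(V + Z) + ½(V - Z).  So δ ↦ A δ is injective on the
-- 2^s vectors δ ∈ {0, 1}ⁿ supported in S = supp v.  The images w(δ) = A (2δ - 1_S) of the sign
-- vectors have mean square Σ_{j ∈ S} ‖Aⱼ‖² ≤ m s Δ² (a second-moment identity), so by Markov
-- two thirds of them have ‖w(δ)‖² ≤ 3 m s Δ²; by Cauchy–Schwarz the corresponding A δ lie in a
-- translated ℓ₁-ball of radius N ≈ √(3 m² s Δ²)/2, which contains at most 2ᵐ C(N + m, m)
-- integer points.  Comparing the two counts and estimating C(N + m, m) gives the bound.

open import Defs


module IntegralVertices where

  open import Data.Nat as ℕ using (zero; suc)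
  open import Data.Integer as ℤ using (ℤ; +_; -[1+_]; ∣_∣)
  import Data.Integer.Properties as ℤP
  open import Data.Integer.Tactic.RingSolver using (solve-∀)
  open import Data.Rational as ℚ using (ℚ; mkℚ; 0ℚ; 1ℚ; _+_; _*_; _≤_; _/_; *≤*)
  import Data.Rational.Properties as ℚP
  import Data.Rational.Unnormalised as ℚᵘ
  open import Data.Nat.Coprimality using (1-coprimeTo) renaming (sym to coprime-sym)
  open import Data.Fin using (Fin; zero; suc)
  import Data.Fin.Properties as FinP
  open import Data.Product using (Σ; _×_; _,_; proj₁; proj₂)
  open import Data.Sum using (_⊎_; inj₁; inj₂)
  open import Data.Empty using (⊥; ⊥-elim)
  open import Relation.Nullary using (¬_; yes; no)
  open import Relation.Binary.PropositionalEquality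

  -- ι a is the fraction a/1 in lowest terms; in this form the laws below reduce to identities
  -- between numerators.
  ι-mkℚ : ∀ a → ι a ≡ mkℚ a 0 (coprime-sym (1-coprimeTo ∣ a ∣))
  ι-mkℚ a = ℚP.fromℚᵘ-toℚᵘ (mkℚ a 0 (coprime-sym (1-coprimeTo ∣ a ∣)))

  ι-+ : ∀ a b → ι (a ℤ.+ b) ≡ ι a + ι b
  ι-+ a b = ℚP.toℚᵘ-injective (ℚᵘ.≃-trans unnormalised (ℚᵘ.≃-sym (ℚP.toℚᵘ-homo-+ (ι a) (ι b))))
    where
    import Data.Rational.Unnormalised.Properties as ℚᵘ
    identity : ∀ a b → (a ℤ.+ b) ℤ.* + 1 ≡ (a ℤ.* + 1 ℤ.+ b ℤ.* + 1) ℤ.* + 1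
    identity = solve-∀
    unnormalised : ℚ.toℚᵘ (ι (a ℤ.+ b)) ℚᵘ.≃ (ℚ.toℚᵘ (ι a) ℚᵘ.+ ℚ.toℚᵘ (ι b))
    unnormalised rewrite ι-mkℚ (a ℤ.+ b) | ι-mkℚ a | ι-mkℚ b = ℚᵘ.*≡* (identity a b)

  ι-* : ∀ a b → ι (a ℤ.* b) ≡ ι a * ι b
  ι-* a b = ℚP.toℚᵘ-injective (ℚᵘ.≃-trans unnormalised (ℚᵘ.≃-sym (ℚP.toℚᵘ-homo-* (ι a) (ι b))))
    where
    import Data.Rational.Unnormalised.Properties as ℚᵘ
    unnormalised : ℚ.toℚᵘ (ι (a ℤ.* b)) ℚᵘ.≃ (ℚ.toℚᵘ (ι a) ℚᵘ.* ℚ.toℚᵘ (ι b))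
    unnormalised rewrite ι-mkℚ (a ℤ.* b) | ι-mkℚ a | ι-mkℚ b = ℚᵘ.*≡* refl

  ι-injective : ∀ {a b} → ι a ≡ ι b → a ≡ b
  ι-injective {a} {b} e =
    trans (sym (ℤP.*-identityʳ a)) (trans (ℚP.drop-*≡* (ℚP.≡⇒≃ e′)) (ℤP.*-identityʳ b))
    where e′ = trans (sym (ι-mkℚ a)) (trans e (ι-mkℚ b))

  ι-nonneg⁻ : ∀ {a} → 0ℚ ≤ ι a → + 0 ℤ.≤ a
  ι-nonneg⁻ {a} h rewrite ι-mkℚ a with h
  ... | *≤* p = subst (+ 0 ℤ.≤_) (ℤP.*-identityʳ a) p

  ι-nonneg : ∀ {a} → + 0 ℤ.≤ a → 0ℚ ≤ ι a
  ι-nonneg {a} h rewrite ι-mkℚ a = *≤* (subst (+ 0 ℤ.≤_) (sym (ℤP.*-identityʳ a)) h)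

  ΣZ : ∀ {k} → (Fin k → ℤ) → ℤ
  ΣZ {zero} f = + 0
  ΣZ {suc k} f = f zero ℤ.+ ΣZ (λ i → f (suc i))

  infix 8 _·_
  _·_ : ∀ {k} → (Fin k → ℤ) → (Fin k → ℤ) → ℤ
  a · x = ΣZ (λ j → a j ℤ.* x j)

  sumℚ-cong : ∀ {k} {f g : Fin k → ℚ} → (∀ j → f j ≡ g j) → sumℚ f ≡ sumℚ g
  sumℚ-cong {zero} e = refl
  sumℚ-cong {suc k} e = cong₂ _+_ (e zero) (sumℚ-cong (λ j → e (suc j)))

  ΣZ-cong : ∀ {k} {f g : Fin k → ℤ} → (∀ j → f j ≡ g j) → ΣZ f ≡ ΣZ g
  ΣZ-cong {zero} e = refl
  ΣZ-cong {suc k} e = cong₂ ℤ._+_ (e zero) (ΣZ-cong (λ j → e (suc j)))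

  sumℚ-ι : ∀ {k} (f : Fin k → ℤ) → sumℚ (λ j → ι (f j)) ≡ ι (ΣZ f)
  sumℚ-ι {zero} f = refl
  sumℚ-ι {suc k} f =
    trans (cong (λ x → ι (f zero) + x) (sumℚ-ι (λ j → f (suc j)))) (sym (ι-+ (f zero) _))

  ΣZ-+ : ∀ {k} (f g : Fin k → ℤ) → ΣZ (λ j → f j ℤ.+ g j) ≡ ΣZ f ℤ.+ ΣZ g
  ΣZ-+ {zero} f g = refl
  ΣZ-+ {suc k} f g rewrite ΣZ-+ (λ j → f (suc j)) (λ j → g (suc j)) =
    +-interchange (f zero) (g zero) _ _
    where open import Algebra.Properties.CommutativeSemigroup ℤP.+-commutativeSemigroup
            renaming (interchange to +-interchange)

  ΣZ-neg : ∀ {k} (f : Fin k → ℤ) → ΣZ (λ j → ℤ.- f j) ≡ ℤ.- ΣZ f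
  ΣZ-neg {zero} f = refl
  ΣZ-neg {suc k} f rewrite ΣZ-neg (λ j → f (suc j)) = sym (ℤP.neg-distrib-+ (f zero) _)

  ·-+ʳ : ∀ {k} (a x y : Fin k → ℤ) → a · (λ j → x j ℤ.+ y j) ≡ a · x ℤ.+ a · y
  ·-+ʳ a x y = trans (ΣZ-cong (λ j → ℤP.*-distribˡ-+ (a j) (x j) (y j))) (ΣZ-+ (λ j → a j ℤ.* x j) (λ j → a j ℤ.* y j))

  ·-negʳ : ∀ {k} (a x : Fin k → ℤ) → a · (λ j → ℤ.- x j) ≡ ℤ.- (a · x)
  ·-negʳ a x = trans (ΣZ-cong (λ j → sym (ℤP.neg-distribʳ-* (a j) (x j)))) (ΣZ-neg (λ j → a j ℤ.* x j))

  ·-ι : ∀ {k} (a x : Fin k → ℤ) → sumℚ (λ j → ι (a j) * ι (x j)) ≡ ι (a · x)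
  ·-ι a x = trans (sumℚ-cong (λ j → sym (ι-* (a j) (x j)))) (sumℚ-ι (λ j → a j ℤ.* x j))

  InPℤ : ∀ {m n} → Matrix m n → (Fin m → ℤ) → (Fin n → ℤ) → Set
  InPℤ A b V = (∀ j → + 0 ℤ.≤ V j) × (∀ i → A i · V ≡ b i)

  InPℤ⇒InP : ∀ {m n} (A : Matrix m n) b V → InPℤ A b V → InP A b (λ j → ι (V j))
  InPℤ⇒InP A b V (V≥0 , AV≡b) =
    (λ j → ι-nonneg (V≥0 j)) , λ i → trans (·-ι (A i) V) (cong ι (AV≡b i))

  conv-singleton : ∀ {n} (S : Vect n → Set) x → S x → InConv S x
  conv-singleton S x Sx =
    1 , (λ _ → x) , (λ _ → 1ℚ) , (λ _ → ℚP.nonNegative⁻¹ 1ℚ) , refl , (λ _ → Sx) ,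
    λ j → sym (trans (ℚP.+-identityʳ _) (ℚP.*-identityˡ _))

  integral⇒InPI : ∀ {m n} (A : Matrix m n) b V → InPℤ A b V → InPI A b (λ j → ι (V j))
  integral⇒InPI A b V h =
    conv-singleton (λ y → InP A b y × IsIntegral y) _ (InPℤ⇒InP A b V h , λ j → V j , refl)

  -- A vertex of P_I is one of the integral points of P whose hull P_I is: otherwise v would be a
  -- convex combination of points of P_I different from v.
  IntegralPoint : ∀ {m n} → Matrix m n → (Fin m → ℤ) → Vect n → Set
  IntegralPoint {n = n} A b v = Σ (Fin n → ℤ) λ V → (∀ j → v j ≡ ι (V j)) × InPℤ A b V

  vertex-integral : ∀ {m n} (A : Matrix m n) b v → IsVertex A b v → IntegralPoint A b v
  vertex-integral {n = n} A b v ((k , p , w , w≥0 , Σw≡1 , p∈ , v≡Σwp) , notInHull)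
    with FinP.any? (λ l → FinP.all? (λ j → p l j ℚP.≟ v j))
  ... | no none≡v = ⊥-elim (notInHull (k , p , w , w≥0 , Σw≡1 , p∈′ , v≡Σwp))
    where
    p∈′ : ∀ l → InPI A b (p l) × ¬ (∀ j → p l j ≡ v j)
    p∈′ l = conv-singleton (λ y → InP A b y × IsIntegral y) (p l) (p∈ l) , λ eq → none≡v (l , eq)
  ... | yes (l , pl≡v) = V , v≡V , V≥0 , AV≡b
    where
    V : Fin n → ℤ
    V j = proj₁ (proj₂ (p∈ l) j)
    pl≡V : ∀ j → p l j ≡ ι (V j)
    pl≡V j = proj₂ (proj₂ (p∈ l) j)
    v≡V : ∀ j → v j ≡ ι (V j)
    v≡V j = trans (sym (pl≡v j)) (pl≡V j)
    V≥0 : ∀ j → + 0 ℤ.≤ V j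
    V≥0 j = ι-nonneg⁻ (subst (0ℚ ≤_) (pl≡V j) (proj₁ (proj₁ (p∈ l)) j))
    AV≡b : ∀ i → A i · V ≡ b i
    AV≡b i = ι-injective (begin
      ι (A i · V)                         ≡⟨ ·-ι (A i) V ⟨
      sumℚ (λ j → ι (A i j) * ι (V j))    ≡⟨ sumℚ-cong (λ j → cong (ι (A i j) *_) (pl≡V j)) ⟨
      sumℚ (λ j → ι (A i j) * p l j)      ≡⟨ proj₂ (proj₁ (p∈ l)) i ⟩
      ι (b i)                             ∎)
      where open ≡-Reasoning

  ½ : ℚ
  ½ = + 1 / 2

  -- ι x is the midpoint of ι (x + z) and ι (x - z), written as the weighted sum sumℚ computes.
  midpoint : ∀ x z → ½ * ι (x ℤ.+ z) + (½ * ι (x ℤ.- z) + 0ℚ) ≡ ι x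
  midpoint x z = begin
    ½ * ι (x ℤ.+ z) + (½ * ι (x ℤ.- z) + 0ℚ)  ≡⟨ cong (λ y → ½ * ι (x ℤ.+ z) + y) (ℚP.+-identityʳ _) ⟩
    ½ * ι (x ℤ.+ z) + ½ * ι (x ℤ.- z)         ≡⟨ ℚP.*-distribˡ-+ ½ (ι (x ℤ.+ z)) (ι (x ℤ.- z)) ⟨
    ½ * (ι (x ℤ.+ z) + ι (x ℤ.- z))           ≡⟨ cong (½ *_) (ι-+ (x ℤ.+ z) (x ℤ.- z)) ⟨
    ½ * ι ((x ℤ.+ z) ℤ.+ (x ℤ.- z))           ≡⟨ cong (λ y → ½ * ι y) (sum-of-steps x z) ⟩
    ½ * ι (+ 2 ℤ.* x)                         ≡⟨ cong (½ *_) (ι-* (+ 2) x) ⟩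
    ½ * (ι (+ 2) * ι x)                       ≡⟨ ℚP.*-assoc ½ (ι (+ 2)) (ι x) ⟨
    1ℚ * ι x                                  ≡⟨ ℚP.*-identityˡ (ι x) ⟩
    ι x                                       ∎
    where
    open ≡-Reasoning
    sum-of-steps : ∀ x z → (x ℤ.+ z) ℤ.+ (x ℤ.- z) ≡ + 2 ℤ.* x
    sum-of-steps = solve-∀

  -- If V ± Z are both integral points of P and Z ≠ 0, then v = ι V is the midpoint of two points
  -- of P_I different from v, so v is not a vertex.
  midpoint-not-vertex : ∀ {m n} (A : Matrix m n) b v (V Z : Fin n → ℤ) →
    IsVertex A b v → (∀ j → v j ≡ ι (V j)) →
    InPℤ A b (λ j → V j ℤ.+ Z j) → InPℤ A b (λ j → V j ℤ.- Z j) →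
    (j₀ : Fin n) → Z j₀ ≢ + 0 → ⊥
  midpoint-not-vertex {n = n} A b v V Z (_ , notInHull) v≡V V+Z∈P V-Z∈P j₀ Zj₀≢0 =
    notInHull (2 , ends , (λ _ → ½) , (λ _ → ℚP.nonNegative⁻¹ ½) , refl , ends∈ , v≡mid)
    where
    ends : Fin 2 → Vect n
    ends zero j = ι (V j ℤ.+ Z j)
    ends (suc _) j = ι (V j ℤ.- Z j)
    cancel : ∀ {y} → ι (V j₀ ℤ.+ y) ≡ v j₀ → y ≡ + 0
    cancel {y} e = +-cancelˡ (V j₀) y (+ 0)
      (trans (ι-injective (trans e (v≡V j₀))) (sym (ℤP.+-identityʳ (V j₀))))
      where open import Algebra.Properties.AbelianGroup ℤP.+-0-abelianGroup using () renaming (∙-cancelˡ to +-cancelˡ)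
    ends∈ : ∀ l → InPI A b (ends l) × ¬ (∀ j → ends l j ≡ v j)
    ends∈ zero = integral⇒InPI A b _ V+Z∈P , λ e → Zj₀≢0 (cancel (e j₀))
    ends∈ (suc zero) = integral⇒InPI A b _ V-Z∈P ,
      λ e → Zj₀≢0 (ℤP.neg-injective (cancel (e j₀)))
    v≡mid : ∀ j → v j ≡ sumℚ (λ l → ½ * ends l j)
    v≡mid j = trans (v≡V j) (sym (midpoint (V j) (Z j)))

  Balanced : ℤ → ℤ → Set
  Balanced x z = (z ≡ + 0) ⊎ ((+ 1 ℤ.≤ x) × ((z ≡ + 1) ⊎ (z ≡ -[1+ 0 ])))

  balanced-nonneg : ∀ x z → + 0 ℤ.≤ x → Balanced x z → (+ 0 ℤ.≤ x ℤ.+ z) × (+ 0 ℤ.≤ x ℤ.- z)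
  balanced-nonneg x .(+ 0) x≥0 (inj₁ refl) =
    subst (+ 0 ℤ.≤_) (sym (ℤP.+-identityʳ x)) x≥0 , subst (+ 0 ℤ.≤_) (sym (ℤP.+-identityʳ x)) x≥0
  balanced-nonneg (+ suc _) _ _ (inj₂ (_ , inj₁ refl)) = ℤ.+≤+ ℕ.z≤n , ℤ.+≤+ ℕ.z≤n
  balanced-nonneg (+ suc _) _ _ (inj₂ (_ , inj₂ refl)) = ℤ.+≤+ ℕ.z≤n , ℤ.+≤+ ℕ.z≤n
  balanced-nonneg (+ zero) _ _ (inj₂ (ℤ.+≤+ () , _))

  no-balanced-kernel-vector : ∀ {m n} (A : Matrix m n) b v → IsVertex A b v →
    ((V , _ , _) : IntegralPoint A b v) → (Z : Fin n → ℤ) → (∀ j → Balanced (V j) (Z j)) →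
    (j₀ : Fin n) → Z j₀ ≢ + 0 → (∀ i → A i · Z ≡ + 0) → ⊥
  no-balanced-kernel-vector A b v vertex (V , v≡V , V≥0 , AV≡b) Z balanced j₀ Zj₀≢0 AZ≡0 =
    midpoint-not-vertex A b v V Z vertex v≡V
      ((λ j → proj₁ (balanced-nonneg (V j) (Z j) (V≥0 j) (balanced j))) , A[V+Z]≡b)
      ((λ j → proj₂ (balanced-nonneg (V j) (Z j) (V≥0 j) (balanced j))) , A[V-Z]≡b)
      j₀ Zj₀≢0
    where
    A[V+Z]≡b : ∀ i → A i · (λ j → V j ℤ.+ Z j) ≡ b i
    A[V+Z]≡b i = begin
      A i · (λ j → V j ℤ.+ Z j)  ≡⟨ ·-+ʳ (A i) V Z ⟩
      A i · V ℤ.+ A i · Z        ≡⟨ cong₂ ℤ._+_ (AV≡b i) (AZ≡0 i) ⟩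
      b i ℤ.+ + 0                ≡⟨ ℤP.+-identityʳ (b i) ⟩
      b i                        ∎
      where open ≡-Reasoning
    A[V-Z]≡b : ∀ i → A i · (λ j → V j ℤ.- Z j) ≡ b i
    A[V-Z]≡b i = begin
      A i · (λ j → V j ℤ.- Z j)  ≡⟨ ·-+ʳ (A i) V (λ j → ℤ.- Z j) ⟩
      A i · V ℤ.+ A i · (λ j → ℤ.- Z j) ≡⟨ cong (λ y → A i · V ℤ.+ y) (·-negʳ (A i) Z) ⟩
      A i · V ℤ.- A i · Z        ≡⟨ cong₂ ℤ._-_ (AV≡b i) (AZ≡0 i) ⟩
      b i ℤ.+ + 0                ≡⟨ ℤP.+-identityʳ (b i) ⟩
      b i                        ∎
      where open ≡-Reasoning


module NatEstimates where

  open import Data.Nat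
  open import Data.Nat.Properties
  open import Data.Nat.Tactic.RingSolver using (solve-∀)
  open import Data.Nat.DivMod using (_/_; _%_; m≡m%n+[m/n]*n; m%n<n; m/n*n≤m)
  open import Data.Fin using (Fin; zero; suc)
  open import Data.Sum using (inj₁; inj₂)
  open import Relation.Nullary using (yes; no; contradiction)
  open import Relation.Binary.PropositionalEquality

  ^-distribʳ-* : ∀ a b n → (a * b) ^ n ≡ a ^ n * b ^ n
  ^-distribʳ-* a b zero = refl
  ^-distribʳ-* a b (suc n) rewrite ^-distribʳ-* a b n = interchange a b (a ^ n) (b ^ n)
    where
    interchange : ∀ a b x y → (a * b) * (x * y) ≡ (a * x) * (b * y)
    interchange = solve-∀

  ^-distribʳ-*₃ : ∀ a b c n → (a * b * c) ^ n ≡ a ^ n * b ^ n * c ^ n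
  ^-distribʳ-*₃ a b c n = trans (^-distribʳ-* (a * b) c n) (cong (_* c ^ n) (^-distribʳ-* a b n))

  square-mono : ∀ {a b} → a ≤ b → a * a ≤ b * b
  square-mono h = *-mono-≤ h h

  two-mul≤sum-sq-ordered : ∀ a d → 2 * (a * (a + d)) ≤ a * a + (a + d) * (a + d)
  two-mul≤sum-sq-ordered a d = begin
    2 * (a * (a + d))                 ≡⟨ expand a d ⟩
    a * a + a * a + 2 * (a * d)       ≤⟨ m≤m+n _ (d * d) ⟩
    a * a + a * a + 2 * (a * d) + d * d ≡⟨ collect a d ⟩
    a * a + (a + d) * (a + d)         ∎
    where
    open ≤-Reasoning
    expand : ∀ a d → 2 * (a * (a + d)) ≡ a * a + a * a + 2 * (a * d)
    expand = solve-∀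
    collect : ∀ a d → a * a + a * a + 2 * (a * d) + d * d ≡ a * a + (a + d) * (a + d)
    collect = solve-∀

  two-mul≤sum-sq : ∀ a b → 2 * (a * b) ≤ a * a + b * b
  two-mul≤sum-sq a b with ≤-total a b
  ... | inj₁ a≤b rewrite sym (m+[n∸m]≡n a≤b) = two-mul≤sum-sq-ordered a (b ∸ a)
  ... | inj₂ b≤a rewrite sym (m+[n∸m]≡n b≤a) =
    subst₂ _≤_ (cong (2 *_) (*-comm b (b + (a ∸ b)))) (+-comm (b * b) _)
      (two-mul≤sum-sq-ordered b (a ∸ b))

  square-sum≤ : ∀ a b → (a + b) * (a + b) ≤ 2 * (a * a) + 2 * (b * b)
  square-sum≤ a b = begin
    (a + b) * (a + b)                 ≡⟨ expand a b ⟩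
    a * a + 2 * (a * b) + b * b       ≤⟨ +-monoˡ-≤ (b * b) (+-monoʳ-≤ (a * a) (two-mul≤sum-sq a b)) ⟩
    a * a + (a * a + b * b) + b * b   ≡⟨ collect a b ⟩
    2 * (a * a) + 2 * (b * b)         ∎
    where
    open ≤-Reasoning
    expand : ∀ a b → (a + b) * (a + b) ≡ a * a + 2 * (a * b) + b * b
    expand = solve-∀
    collect : ∀ a b → a * a + (a * a + b * b) + b * b ≡ 2 * (a * a) + 2 * (b * b)
    collect = solve-∀

  ΣN : ∀ {k} → (Fin k → ℕ) → ℕ
  ΣN {zero} f = 0
  ΣN {suc k} f = f zero + ΣN (λ i → f (suc i))

  ΣN-cong : ∀ {k} {f g : Fin k → ℕ} → (∀ i → f i ≡ g i) → ΣN f ≡ ΣN g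
  ΣN-cong {zero} e = refl
  ΣN-cong {suc k} e = cong₂ _+_ (e zero) (ΣN-cong (λ i → e (suc i)))

  ΣN-mono : ∀ {k} {f g : Fin k → ℕ} → (∀ i → f i ≤ g i) → ΣN f ≤ ΣN g
  ΣN-mono {zero} h = z≤n
  ΣN-mono {suc k} h = +-mono-≤ (h zero) (ΣN-mono (λ i → h (suc i)))

  ΣN-+ : ∀ {k} (f g : Fin k → ℕ) → ΣN (λ i → f i + g i) ≡ ΣN f + ΣN g
  ΣN-+ {zero} f g = refl
  ΣN-+ {suc k} f g rewrite ΣN-+ (λ i → f (suc i)) (λ i → g (suc i)) =
    +-interchange (f zero) (g zero) _ _
    where open import Algebra.Properties.CommutativeSemigroup +-commutativeSemigroup
            renaming (interchange to +-interchange)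

  ΣN-* : ∀ {k} c (f : Fin k → ℕ) → ΣN (λ i → c * f i) ≡ c * ΣN f
  ΣN-* {zero} c f = sym (*-zeroʳ c)
  ΣN-* {suc k} c f rewrite ΣN-* c (λ i → f (suc i)) = sym (*-distribˡ-+ c (f zero) _)

  ΣN-const : ∀ k c → ΣN {k} (λ _ → c) ≡ k * c
  ΣN-const zero c = refl
  ΣN-const (suc k) c = cong (c +_) (ΣN-const k c)

  -- Cauchy–Schwarz: (Σ_{i<k} fᵢ)² ≤ k Σ_{i<k} fᵢ².  The inductive step needs
  -- 2xS ≤ k x² + Q whenever S² ≤ k Q, which follows from 2(kx)S ≤ (kx)² + S².
  cauchy-schwarz-step : ∀ k x S Q → S * S ≤ k * Q → 2 * (x * S) ≤ k * (x * x) + Q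
  cauchy-schwarz-step zero x zero Q _ = subst (_≤ Q) (cong (2 *_) (sym (*-zeroʳ x))) z≤n
  cauchy-schwarz-step zero x (suc S) Q ()
  cauchy-schwarz-step (suc k) x S Q S²≤kQ = *-cancelˡ-≤ (suc k) (begin
    suc k * (2 * (x * S))                     ≡⟨ identity₁ (suc k) x S ⟩
    2 * ((suc k * x) * S)                     ≤⟨ two-mul≤sum-sq (suc k * x) S ⟩
    (suc k * x) * (suc k * x) + S * S         ≤⟨ +-monoʳ-≤ ((suc k * x) * (suc k * x)) S²≤kQ ⟩
    (suc k * x) * (suc k * x) + suc k * Q     ≡⟨ identity₂ (suc k) x Q ⟩
    suc k * (suc k * (x * x) + Q)             ∎)
    where
    open ≤-Reasoning
    identity₁ : ∀ k x S → k * (2 * (x * S)) ≡ 2 * ((k * x) * S)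
    identity₁ = solve-∀
    identity₂ : ∀ k x Q → (k * x) * (k * x) + k * Q ≡ k * (k * (x * x) + Q)
    identity₂ = solve-∀

  cauchy-schwarz : ∀ {k} (f : Fin k → ℕ) → ΣN f * ΣN f ≤ k * ΣN (λ i → f i * f i)
  cauchy-schwarz {zero} f = z≤n
  cauchy-schwarz {suc k} f = begin
    (x + S) * (x + S)                 ≡⟨ expand x S ⟩
    x * x + 2 * (x * S) + S * S       ≤⟨ +-mono-≤ (+-monoʳ-≤ (x * x) (cauchy-schwarz-step k x S Q IH)) IH ⟩
    x * x + (k * (x * x) + Q) + k * Q ≡⟨ collect x k Q ⟩
    suc k * (x * x + Q)               ∎
    where
    open ≤-Reasoning
    x = f zero
    S = ΣN (λ i → f (suc i))
    Q = ΣN (λ i → f (suc i) * f (suc i))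
    IH : S * S ≤ k * Q
    IH = cauchy-schwarz (λ i → f (suc i))
    expand : ∀ x S → (x + S) * (x + S) ≡ x * x + 2 * (x * S) + S * S
    expand = solve-∀
    collect : ∀ x k Q → x * x + (k * (x * x) + Q) + k * Q ≡ suc k * (x * x + Q)
    collect = solve-∀

  bernoulli : ∀ X k → X ^ suc k + suc k * X ^ k ≤ suc X ^ suc k
  bernoulli X zero = ≤-reflexive (base X)
    where
    base : ∀ X → X * 1 + 1 * 1 ≡ suc X * 1
    base = solve-∀
  bernoulli X (suc k) = begin
    X ^ suc (suc k) + suc (suc k) * X ^ suc k     ≡⟨ regroup X (X ^ suc k) k ⟩
    suc X * X ^ suc k + suc k * X ^ suc k         ≤⟨ +-monoʳ-≤ (suc X * X ^ suc k) (*-monoʳ-≤ (suc k) (*-monoˡ-≤ (X ^ k) (n≤1+n X))) ⟩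
    suc X * X ^ suc k + suc k * (suc X * X ^ k)   ≡⟨ factor X (X ^ suc k) (X ^ k) k ⟩
    suc X * (X ^ suc k + suc k * X ^ k)           ≤⟨ *-monoʳ-≤ (suc X) (bernoulli X k) ⟩
    suc X * suc X ^ suc k                         ∎
    where
    open ≤-Reasoning
    regroup : ∀ X p k → X * p + (2 + k) * p ≡ suc X * p + suc k * p
    regroup = solve-∀
    factor : ∀ X p q k → suc X * p + suc k * (suc X * q) ≡ suc X * (p + suc k * q)
    factor = solve-∀

  -- (n+1)^j · t ≤ n^(j+1) for n = j + t, a discrete form of (1 + 1/n)^j ≤ n/t.
  power-ratio : ∀ j t → suc (j + t) ^ j * t ≤ (j + t) ^ suc j
  power-ratio zero t = ≤-reflexive (*-comm 1 t)
  power-ratio (suc j) t = begin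
    suc n ^ suc j * t                 ≡⟨ swap (suc n) (suc n ^ j) t ⟩
    suc n ^ j * (suc n * t)           ≤⟨ *-monoʳ-≤ (suc n ^ j) shift ⟩
    suc n ^ j * (n * suc t)           ≡⟨ swap′ (suc n ^ j) n (suc t) ⟩
    n * (suc n ^ j * suc t)           ≡⟨ cong (λ x → n * (suc x ^ j * suc t)) n≡j+suc[t] ⟩
    n * (suc (j + suc t) ^ j * suc t) ≤⟨ *-monoʳ-≤ n (power-ratio j (suc t)) ⟩
    n * (j + suc t) ^ suc j           ≡⟨ cong (λ x → n * x ^ suc j) (sym n≡j+suc[t]) ⟩
    n * n ^ suc j                     ∎
    where
    open ≤-Reasoning
    n = suc j + t
    n≡j+suc[t] : n ≡ j + suc t
    n≡j+suc[t] = sym (+-suc j t)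
    swap : ∀ a p t → a * p * t ≡ p * (a * t)
    swap = solve-∀
    swap′ : ∀ p n t → p * (n * t) ≡ n * (p * t)
    swap′ = solve-∀
    -- (n+1) t = t + n t ≤ n + n t = n (t+1) since t ≤ n
    shift : suc n * t ≤ n * suc t
    shift = subst (suc n * t ≤_) (sym (*-suc n t)) (+-monoˡ-≤ (n * t) (m≤n+m t (suc j)))

  -- Splitting m = a + b and applying power-ratio to both parts: (m+1)^m · ab ≤ mᵐ · m².
  growth-split : ∀ a b → suc (a + b) ^ (a + b) * (a * b) ≤ (a + b) ^ (a + b) * ((a + b) * (a + b))
  growth-split a b = begin
    suc m ^ (a + b) * (a * b)             ≡⟨ cong (_* (a * b)) (^-distribˡ-+-* (suc m) a b) ⟩
    suc m ^ a * suc m ^ b * (a * b)       ≡⟨ regroup (suc m ^ a) (suc m ^ b) a b ⟩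
    (suc m ^ a * b) * (suc m ^ b * a)     ≤⟨ *-mono-≤ (power-ratio a b) ratio-b ⟩
    m ^ suc a * m ^ suc b                 ≡⟨ ^-distribˡ-+-* m (suc a) (suc b) ⟨
    m ^ (suc a + suc b)                   ≡⟨ cong (m ^_) (exponent a b) ⟩
    m ^ (m + 2)                           ≡⟨ ^-distribˡ-+-* m m 2 ⟩
    m ^ m * (m * (m * 1))                 ≡⟨ cong (λ x → m ^ m * (m * x)) (*-identityʳ m) ⟩
    m ^ m * (m * m)                       ∎
    where
    open ≤-Reasoning
    m = a + b
    ratio-b : suc m ^ b * a ≤ m ^ suc b
    ratio-b = subst (λ x → suc x ^ b * a ≤ x ^ suc b) (+-comm b a) (power-ratio b a)
    regroup : ∀ p q a b → p * q * (a * b) ≡ (p * b) * (q * a)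
    regroup = solve-∀
    exponent : ∀ a b → suc a + suc b ≡ a + b + 2
    exponent = solve-∀

  square≤5*mul : ∀ a b → a ≤ b → b ≤ 2 * a → (a + b) * (a + b) ≤ 5 * (a * b)
  square≤5*mul a b a≤b b≤2a = begin
    (a + b) * (a + b)                 ≡⟨ expand a b ⟩
    a * a + 2 * (a * b) + b * b       ≤⟨ +-mono-≤ (+-monoˡ-≤ (2 * (a * b)) (*-monoʳ-≤ a a≤b)) (*-monoˡ-≤ b b≤2a) ⟩
    a * b + 2 * (a * b) + 2 * a * b   ≡⟨ collect a b ⟩
    5 * (a * b)                       ∎
    where
    open ≤-Reasoning
    expand : ∀ a b → (a + b) * (a + b) ≡ a * a + 2 * (a * b) + b * b
    expand = solve-∀
    collect : ∀ a b → a * b + 2 * (a * b) + 2 * a * b ≡ 5 * (a * b)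
    collect = solve-∀

  ⌈n/2⌉≤1+⌊n/2⌋ : ∀ n → ⌈ n /2⌉ ≤ suc ⌊ n /2⌋
  ⌈n/2⌉≤1+⌊n/2⌋ zero = z≤n
  ⌈n/2⌉≤1+⌊n/2⌋ (suc zero) = s≤s z≤n
  ⌈n/2⌉≤1+⌊n/2⌋ (suc (suc n)) = s≤s (⌈n/2⌉≤1+⌊n/2⌋ n)

  -- (1 + 1/m)^m ≤ 5, in the form (m+1)^m ≤ 5 mᵐ; for m ≥ 2 split m = ⌊m/2⌋ + ⌈m/2⌉.
  growth : ∀ m → suc m ^ m ≤ 5 * m ^ m
  growth zero = s≤s z≤n
  growth (suc zero) = s≤s (s≤s z≤n)
  growth m@(suc (suc n)) = subst (λ x → suc x ^ x ≤ 5 * x ^ x) (⌊n/2⌋+⌈n/2⌉≡n m)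
    (*-cancelʳ-≤ _ _ (a * b) {{ab≢0}} (begin
      suc (a + b) ^ (a + b) * (a * b)         ≤⟨ growth-split a b ⟩
      (a + b) ^ (a + b) * ((a + b) * (a + b)) ≤⟨ *-monoʳ-≤ ((a + b) ^ (a + b)) (square≤5*mul a b a≤b b≤2a) ⟩
      (a + b) ^ (a + b) * (5 * (a * b))       ≡⟨ move-5 ((a + b) ^ (a + b)) (a * b) ⟩
      5 * (a + b) ^ (a + b) * (a * b)         ∎))
    where
    open ≤-Reasoning
    a = ⌊ m /2⌋
    b = ⌈ m /2⌉
    a≤b : a ≤ b
    a≤b = ⌊n/2⌋≤⌈n/2⌉ m
    b≤2a : b ≤ 2 * a
    b≤2a = begin
      b         ≤⟨ ⌈n/2⌉≤1+⌊n/2⌋ m ⟩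
      suc a     ≡⟨ +-comm 1 a ⟩
      a + 1     ≤⟨ +-monoʳ-≤ a (s≤s z≤n) ⟩
      a + a     ≡⟨ cong (a +_) (+-identityʳ a) ⟨
      2 * a     ∎
    ab≢0 : NonZero (a * b)
    ab≢0 = m*n≢0 a b {{_}} {{_}}
    move-5 : ∀ p x → p * (5 * x) ≡ 5 * p * x
    move-5 = solve-∀

  power≤5^*factorial : ∀ m → m ^ m ≤ 5 ^ m * m !
  power≤5^*factorial zero = s≤s z≤n
  power≤5^*factorial (suc m) = begin
    suc m * suc m ^ m           ≤⟨ *-monoʳ-≤ (suc m) (growth m) ⟩
    suc m * (5 * m ^ m)         ≤⟨ *-monoʳ-≤ (suc m) (*-monoʳ-≤ 5 (power≤5^*factorial m)) ⟩
    suc m * (5 * (5 ^ m * m !)) ≡⟨ regroup (suc m) (5 ^ m) (m !) ⟩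
    5 * 5 ^ m * (suc m * m !)   ∎
    where
    open ≤-Reasoning
    regroup : ∀ s p f → s * (5 * (p * f)) ≡ 5 * p * (s * f)
    regroup = solve-∀

  suc≤2^ : ∀ t → suc t ≤ 2 ^ t
  suc≤2^ zero = s≤s z≤n
  suc≤2^ (suc t) = begin
    suc (suc t)     ≤⟨ s≤s (m≤n+m (suc t) t) ⟩
    suc t + suc t   ≡⟨ cong (suc t +_) (+-identityʳ (suc t)) ⟨
    2 * suc t       ≤⟨ *-monoʳ-≤ 2 (suc≤2^ t) ⟩
    2 * 2 ^ t       ∎
    where open ≤-Reasoning

  -- A power is dominated by an exponential: s^m ≤ m^m 2^s for m ≥ 1.  Writing t = ⌊s/m⌋ we have
  -- s ≤ m (t + 1) and t + 1 ≤ 2^t, so s^m ≤ m^m 2^(t m) ≤ m^m 2^s.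
  power≤exponential : ∀ s k → s ^ suc k ≤ suc k ^ suc k * 2 ^ s
  power≤exponential s k = begin
    s ^ m                   ≤⟨ ^-monoˡ-≤ m s≤m[t+1] ⟩
    (m * suc t) ^ m         ≡⟨ ^-distribʳ-* m (suc t) m ⟩
    m ^ m * suc t ^ m       ≤⟨ *-monoʳ-≤ (m ^ m) (^-monoˡ-≤ m (suc≤2^ t)) ⟩
    m ^ m * (2 ^ t) ^ m     ≡⟨ cong (m ^ m *_) (^-*-assoc 2 t m) ⟩
    m ^ m * 2 ^ (t * m)     ≤⟨ *-monoʳ-≤ (m ^ m) (^-monoʳ-≤ 2 (m/n*n≤m s m)) ⟩
    m ^ m * 2 ^ s           ∎
    where
    open ≤-Reasoning
    m = suc k
    t = s / m
    s≤m[t+1] : s ≤ m * suc t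
    s≤m[t+1] = begin
      s               ≡⟨ m≡m%n+[m/n]*n s m ⟩
      s % m + t * m   ≤⟨ +-monoˡ-≤ (t * m) (<⇒≤ (m%n<n s m)) ⟩
      m + t * m       ≡⟨ cong (m +_) (*-comm t m) ⟩
      m + m * t       ≡⟨ *-suc m t ⟨
      m * suc t       ∎

  isqrt-below : ℕ → ℕ → ℕ
  isqrt-below zero M = 0
  isqrt-below (suc k) M with suc k * suc k ≤? M
  ... | yes _ = suc k
  ... | no _ = isqrt-below k M

  isqrt : ℕ → ℕ
  isqrt M = isqrt-below M M

  isqrt-below-sound : ∀ k M → isqrt-below k M * isqrt-below k M ≤ M
  isqrt-below-sound zero M = z≤n
  isqrt-below-sound (suc k) M with suc k * suc k ≤? M
  ... | yes h = h
  ... | no _ = isqrt-below-sound k M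

  isqrt-below-maximal : ∀ k M x → x ≤ k → x * x ≤ M → x ≤ isqrt-below k M
  isqrt-below-maximal zero M .zero z≤n _ = z≤n
  isqrt-below-maximal (suc k) M x x≤1+k x²≤M with suc k * suc k ≤? M
  ... | yes _ = x≤1+k
  ... | no [1+k]²≰M with m≤n⇒m<n∨m≡n x≤1+k
  ...   | inj₁ x<1+k = isqrt-below-maximal k M x (≤-pred x<1+k) x²≤M
  ...   | inj₂ refl = contradiction x²≤M [1+k]²≰M

  isqrt-sound : ∀ M → isqrt M * isqrt M ≤ M
  isqrt-sound M = isqrt-below-sound M M

  isqrt-maximal : ∀ M x → x * x ≤ M → x ≤ isqrt M
  isqrt-maximal M zero _ = z≤n
  isqrt-maximal M (suc x) x²≤M = isqrt-below-maximal M M (suc x) (≤-trans (m≤m*n (suc x) (suc x)) x²≤M) x²≤M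

  -- The arithmetic that turns the counting bound into the theorem, with m = k + 1.
  -- Step 1: 2·2^s ≤ 3·2^m C and C m! ≤ (N+m)^m give 2·2^s·mᵐ ≤ 3·10ᵐ (N+m)ᵐ, since mᵐ ≤ 5ᵐ m!.
  count⇒power : ∀ k s C N → 2 * 2 ^ s ≤ 3 * (C * 2 ^ suc k) → C * suc k ! ≤ (N + suc k) ^ suc k →
    2 * 2 ^ s * suc k ^ suc k ≤ 3 * 10 ^ suc k * (N + suc k) ^ suc k
  count⇒power k s C N 2^s≤C C≤ = begin
    2 * 2 ^ s * m ^ m                   ≤⟨ *-monoˡ-≤ (m ^ m) 2^s≤C ⟩
    3 * (C * 2 ^ m) * m ^ m             ≤⟨ *-monoʳ-≤ (3 * (C * 2 ^ m)) (power≤5^*factorial m) ⟩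
    3 * (C * 2 ^ m) * (5 ^ m * m !)     ≡⟨ regroup C (2 ^ m) (5 ^ m) (m !) ⟩
    3 * (2 ^ m * 5 ^ m) * (C * m !)     ≡⟨ cong (λ x → 3 * x * (C * m !)) (^-distribʳ-* 2 5 m) ⟨
    3 * 10 ^ m * (C * m !)              ≤⟨ *-monoʳ-≤ (3 * 10 ^ m) C≤ ⟩
    3 * 10 ^ m * (N + m) ^ m            ∎
    where
    open ≤-Reasoning
    m = suc k
    regroup : ∀ c a b f → 3 * (c * a) * (b * f) ≡ 3 * (a * b) * (c * f)
    regroup = solve-∀

  radius-bound : ∀ m q N r → N + N ≤ r + m → r * r ≤ m * (3 * (m * q)) → 5 ≤ q →
    100 * ((N + m) * (N + m)) ≤ 250 * (m * m) * q
  radius-bound m q N r 2N≤r+m r²≤ 5≤q = begin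
    100 * ((N + m) * (N + m))                      ≡⟨ double N m ⟩
    25 * ((N + N + 2 * m) * (N + N + 2 * m))       ≤⟨ *-monoʳ-≤ 25 (square-mono (+-monoˡ-≤ (2 * m) 2N≤r+m)) ⟩
    25 * ((r + m + 2 * m) * (r + m + 2 * m))       ≡⟨ cong (λ x → 25 * (x * x)) (gather r m) ⟩
    25 * ((r + 3 * m) * (r + 3 * m))               ≤⟨ *-monoʳ-≤ 25 (square-sum≤ r (3 * m)) ⟩
    25 * (2 * (r * r) + 2 * (3 * m * (3 * m)))     ≤⟨ *-monoʳ-≤ 25 (+-monoˡ-≤ _ (*-monoʳ-≤ 2 r²≤)) ⟩
    25 * (2 * (m * (3 * (m * q))) + 2 * (3 * m * (3 * m))) ≡⟨ expand m q ⟩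
    150 * (m * m) * q + 90 * (m * m) * 5           ≤⟨ +-monoʳ-≤ (150 * (m * m) * q) (*-monoʳ-≤ (90 * (m * m)) 5≤q) ⟩
    150 * (m * m) * q + 90 * (m * m) * q           ≤⟨ +-monoʳ-≤ (150 * (m * m) * q) (*-monoˡ-≤ q (*-monoˡ-≤ (m * m) (m≤m+n 90 10))) ⟩
    150 * (m * m) * q + 100 * (m * m) * q          ≡⟨ collect (m * m) q ⟩
    250 * (m * m) * q                              ∎
    where
    open ≤-Reasoning
    double : ∀ N m → 100 * ((N + m) * (N + m)) ≡ 25 * ((N + N + 2 * m) * (N + N + 2 * m))
    double = solve-∀
    gather : ∀ r m → r + m + 2 * m ≡ r + 3 * m
    gather = solve-∀
    expand : ∀ m q → 25 * (2 * (m * (3 * (m * q))) + 2 * (3 * m * (3 * m)))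
                     ≡ 150 * (m * m) * q + 90 * (m * m) * 5
    expand = solve-∀
    collect : ∀ x q → 150 * x * q + 100 * x * q ≡ 250 * x * q
    collect = solve-∀

  -- Step 3: squaring step 1 and inserting step 2 gives (2^s)² ≤ 576ᵐ qᵐ, since 9·250ᵐ ≤ 4·576ᵐ.
  squared-bound : ∀ k s q C N r → 2 * 2 ^ s ≤ 3 * (C * 2 ^ suc k) → C * suc k ! ≤ (N + suc k) ^ suc k →
    N + N ≤ r + suc k → r * r ≤ suc k * (3 * (suc k * q)) → 5 ≤ q →
    2 ^ s * 2 ^ s ≤ 576 ^ suc k * q ^ suc k
  squared-bound k s q C N r 2^s≤C C≤ 2N≤r+m r²≤ 5≤q =
    *-cancelˡ-≤ 4 (*-cancelʳ-≤ _ _ M {{M≢0}} (begin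
      4 * (L * L) * M                               ≡⟨ square-of L (m ^ m) ⟩
      (2 * L * m ^ m) * (2 * L * m ^ m)             ≤⟨ square-mono (count⇒power k s C N 2^s≤C C≤) ⟩
      (3 * 10 ^ m * P) * (3 * 10 ^ m * P)           ≡⟨ nine (10 ^ m) P ⟩
      9 * ((10 ^ m * 10 ^ m) * (P * P))             ≡⟨ cong (9 *_) (cong₂ _*_ (^-distribʳ-* 10 10 m) (^-distribʳ-* (N + m) (N + m) m)) ⟨
      9 * (100 ^ m * ((N + m) * (N + m)) ^ m)       ≡⟨ cong (9 *_) (^-distribʳ-* 100 ((N + m) * (N + m)) m) ⟨
      9 * (100 * ((N + m) * (N + m))) ^ m           ≤⟨ *-monoʳ-≤ 9 (^-monoˡ-≤ m (radius-bound m q N r 2N≤r+m r²≤ 5≤q)) ⟩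
      9 * (250 * (m * m) * q) ^ m                   ≡⟨ cong (9 *_) (^-distribʳ-*₃ 250 (m * m) q m) ⟩
      9 * (250 ^ m * (m * m) ^ m * q ^ m)           ≡⟨ cong (λ x → 9 * (250 ^ m * x * q ^ m)) (^-distribʳ-* m m m) ⟩
      9 * (250 ^ m * M * q ^ m)                     ≡⟨ regroup (250 ^ m) M (q ^ m) ⟩
      9 * 250 ^ m * q ^ m * M                       ≤⟨ *-monoˡ-≤ M (*-monoˡ-≤ (q ^ m) constants) ⟩
      4 * 576 ^ m * q ^ m * M                       ≡⟨ cong (_* M) (*-assoc 4 (576 ^ m) (q ^ m)) ⟩
      4 * (576 ^ m * q ^ m) * M                     ∎))
    where
    open ≤-Reasoning
    m = suc k
    L = 2 ^ s
    M = m ^ m * m ^ m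
    P = (N + m) ^ m
    M≢0 : NonZero M
    M≢0 = m*n≢0 (m ^ m) (m ^ m) {{m^n≢0 m m}} {{m^n≢0 m m}}
    square-of : ∀ l p → 4 * (l * l) * (p * p) ≡ (2 * l * p) * (2 * l * p)
    square-of = solve-∀
    nine : ∀ a p → (3 * a * p) * (3 * a * p) ≡ 9 * ((a * a) * (p * p))
    nine = solve-∀
    regroup : ∀ a x b → 9 * (a * x * b) ≡ 9 * a * b * x
    regroup = solve-∀
    constants : 9 * 250 ^ m ≤ 4 * 576 ^ m
    constants = begin
      9 * (250 * 250 ^ k)   ≡⟨ *-assoc 9 250 (250 ^ k) ⟨
      2250 * 250 ^ k        ≤⟨ *-mono-≤ (m≤m+n 2250 54) (^-monoˡ-≤ k (m≤m+n 250 326)) ⟩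
      2304 * 576 ^ k        ≡⟨ *-assoc 4 576 (576 ^ k) ⟩
      4 * (576 * 576 ^ k)   ∎

  -- Step 4: with q = s D² and s^m ≤ mᵐ 2^s, dividing by 2^s yields 2^s ≤ (576 m D²)ᵐ.
  support-arithmetic : ∀ k D s C N r → 1 ≤ D → 5 ≤ s →
    2 * 2 ^ s ≤ 3 * (C * 2 ^ suc k) → C * suc k ! ≤ (N + suc k) ^ suc k →
    N + N ≤ r + suc k → r * r ≤ suc k * (3 * (suc k * (s * (D * D)))) →
    2 ^ s ≤ (576 * suc k * (D * D)) ^ suc k
  support-arithmetic k D s C N r D≥1 s≥5 2^s≤C C≤ 2N≤r+m r²≤ =
    *-cancelʳ-≤ L _ L {{m^n≢0 2 s}} (begin
      L * L                                   ≤⟨ squared-bound k s q C N r 2^s≤C C≤ 2N≤r+m r²≤ q≥5 ⟩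
      576 ^ m * q ^ m                         ≡⟨ cong (576 ^ m *_) (^-distribʳ-* s (D * D) m) ⟩
      576 ^ m * (s ^ m * (D * D) ^ m)         ≤⟨ *-monoʳ-≤ (576 ^ m) (*-monoˡ-≤ ((D * D) ^ m) (power≤exponential s k)) ⟩
      576 ^ m * (m ^ m * L * (D * D) ^ m)     ≡⟨ regroup (576 ^ m) (m ^ m) L ((D * D) ^ m) ⟩
      576 ^ m * m ^ m * (D * D) ^ m * L       ≡⟨ cong (_* L) (^-distribʳ-*₃ 576 m (D * D) m) ⟨
      (576 * m * (D * D)) ^ m * L             ∎)
    where
    open ≤-Reasoning
    m = suc k
    L = 2 ^ s
    q = s * (D * D)
    q≥5 : 5 ≤ q
    q≥5 = ≤-trans s≥5 (m≤m*n s (D * D) {{>-nonZero (*-mono-≤ D≥1 D≥1)}})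
    regroup : ∀ a b l c → a * (b * l * c) ≡ a * b * c * l
    regroup = solve-∀


module FiniteCounting where

  open import Data.Nat
  open import Data.Nat.Properties
  open import Data.Nat.ListAction using (sum)
  open import Data.Nat.Tactic.RingSolver using (solve-∀)
  open import Data.Vec using (Vec; []; _∷_)
  open import Data.List using (List; []; _∷_; _++_; map; length; filter; cartesianProductWith)
  open import Data.List.Properties using (length-map; length-++; filter-accept; filter-reject)
  open import Data.List.Membership.Propositional using (_∈_)
  open import Data.List.Membership.Propositional.Properties using (∈-map⁺; ∈-++⁺ˡ; ∈-++⁺ʳ; ∈-cartesianProductWith⁺)
  open import Data.List.Relation.Unary.Any using (here; there)
  open import Data.List.Relation.Unary.All as All using ()
  open import Data.List.Relation.Unary.AllPairs using (AllPairs; []; _∷_)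
  open import Data.Empty using (⊥-elim)
  open import Relation.Nullary using (yes; no)
  open import Relation.Binary.PropositionalEquality
  open NatEstimates using (bernoulli)

  module _ {A : Set} where

    remove : ∀ {x : A} (ys : List A) → x ∈ ys → List A
    remove (_ ∷ ys) (here _) = ys
    remove (y ∷ ys) (there p) = y ∷ remove ys p

    length-remove : ∀ {x : A} (ys : List A) (p : x ∈ ys) → suc (length (remove ys p)) ≡ length ys
    length-remove (_ ∷ ys) (here _) = refl
    length-remove (_ ∷ ys) (there p) = cong suc (length-remove ys p)

    ∈-remove : ∀ {x y : A} (ys : List A) (p : x ∈ ys) → y ∈ ys → y ≢ x → y ∈ remove ys p
    ∈-remove (_ ∷ ys) (here refl) (here refl) y≢x = ⊥-elim (y≢x refl)
    ∈-remove (_ ∷ ys) (here refl) (there q) _ = q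
    ∈-remove (_ ∷ ys) (there p) (here e) _ = here e
    ∈-remove (_ ∷ ys) (there p) (there q) y≢x = there (∈-remove ys p q y≢x)

    distinct-length≤ : ∀ (xs ys : List A) → AllPairs _≢_ xs → (∀ {x} → x ∈ xs → x ∈ ys) →
      length xs ≤ length ys
    distinct-length≤ [] ys _ _ = z≤n
    distinct-length≤ (x ∷ xs) ys (x∉xs ∷ distinct) xs⊆ys =
      subst (suc (length xs) ≤_) (length-remove ys x∈ys)
        (s≤s (distinct-length≤ xs (remove ys x∈ys) distinct
          (λ y∈xs → ∈-remove ys x∈ys (xs⊆ys (there y∈xs)) (λ y≡x → All.lookup x∉xs y∈xs (sym y≡x)))))
      where
      x∈ys = xs⊆ys (here refl)

    length-cartesianProductWith : ∀ {B C : Set} (f : A → B → C) (xs : List A) (ys : List B) →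
      length (cartesianProductWith f xs ys) ≡ length xs * length ys
    length-cartesianProductWith f [] ys = refl
    length-cartesianProductWith f (x ∷ xs) ys =
      trans (length-++ (map (f x) ys)) (cong₂ _+_ (length-map _ ys) (length-cartesianProductWith f xs ys))

    vectors-over : List A → (m : ℕ) → List (Vec A m)
    vectors-over xs zero = [] ∷ []
    vectors-over xs (suc m) = cartesianProductWith _∷_ xs (vectors-over xs m)

    length-vectors-over : ∀ xs m → length (vectors-over xs m) ≡ length xs ^ m
    length-vectors-over xs zero = refl
    length-vectors-over xs (suc m) =
      trans (length-cartesianProductWith _∷_ xs (vectors-over xs m)) (cong (length xs *_) (length-vectors-over xs m))

    ∈-vectors-over : ∀ {xs m} (as : Vec A m) → (∀ a → a ∈ xs) → as ∈ vectors-over xs m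
    ∈-vectors-over [] _ = here refl
    ∈-vectors-over (a ∷ as) complete = ∈-cartesianProductWith⁺ _∷_ (complete a) (∈-vectors-over as complete)

  vec-sum : ∀ {m} → Vec ℕ m → ℕ
  vec-sum [] = 0
  vec-sum (x ∷ xs) = x + vec-sum xs

  bounded-vectors : (m N : ℕ) → List (Vec ℕ m)
  bounded-vectors zero N = [] ∷ []
  bounded-vectors (suc m) zero = map (0 ∷_) (bounded-vectors m 0)
  bounded-vectors (suc m) (suc N) =
    map (0 ∷_) (bounded-vectors m (suc N)) ++ map increment-head (bounded-vectors (suc m) N)
    where
    increment-head : ∀ {m} → Vec ℕ (suc m) → Vec ℕ (suc m)
    increment-head (x ∷ xs) = suc x ∷ xs

  ∈-bounded-vectors : ∀ {m} N (xs : Vec ℕ m) → vec-sum xs ≤ N → xs ∈ bounded-vectors m N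
  ∈-bounded-vectors {zero} N [] _ = here refl
  ∈-bounded-vectors {suc m} zero (zero ∷ xs) h = ∈-map⁺ (0 ∷_) (∈-bounded-vectors 0 xs h)
  ∈-bounded-vectors {suc m} (suc N) (zero ∷ xs) h =
    ∈-++⁺ˡ (∈-map⁺ (0 ∷_) (∈-bounded-vectors (suc N) xs h))
  ∈-bounded-vectors {suc m} (suc N) (suc x ∷ xs) (s≤s h) =
    ∈-++⁺ʳ (map (0 ∷_) (bounded-vectors m (suc N))) (∈-map⁺ _ (∈-bounded-vectors N (x ∷ xs) h))

  length-bounded-vectors : ∀ m N → length (bounded-vectors m N) * m ! ≤ (N + m) ^ m
  length-bounded-vectors zero N = ≤-refl
  length-bounded-vectors (suc m) zero = begin
    length (map (0 ∷_) (bounded-vectors m 0)) * (suc m * m !)  ≡⟨ cong (_* (suc m * m !)) (length-map _ (bounded-vectors m 0)) ⟩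
    length (bounded-vectors m 0) * (suc m * m !)   ≡⟨ swap (length (bounded-vectors m 0)) (suc m) (m !) ⟩
    suc m * (length (bounded-vectors m 0) * m !)   ≤⟨ *-monoʳ-≤ (suc m) (length-bounded-vectors m 0) ⟩
    suc m * m ^ m                                  ≤⟨ *-monoʳ-≤ (suc m) (^-monoˡ-≤ m (n≤1+n m)) ⟩
    suc m * suc m ^ m                              ∎
    where
    open ≤-Reasoning
    swap : ∀ t s f → t * (s * f) ≡ s * (t * f)
    swap = solve-∀
  length-bounded-vectors (suc m) (suc N) = begin
    length (bounded-vectors (suc m) (suc N)) * (suc m * m !)   ≡⟨ cong (_* (suc m * m !)) count ⟩
    (a + b) * (suc m * m !)                         ≡⟨ split a b (suc m) (m !) ⟩
    suc m * (a * m !) + b * (suc m * m !)           ≤⟨ +-mono-≤ (*-monoʳ-≤ (suc m) (length-bounded-vectors m (suc N))) (length-bounded-vectors (suc m) N) ⟩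
    suc m * X ^ m + (N + suc m) ^ suc m             ≡⟨ cong (λ y → suc m * X ^ m + y ^ suc m) (+-suc N m) ⟩
    suc m * X ^ m + X ^ suc m                       ≡⟨ +-comm (suc m * X ^ m) (X ^ suc m) ⟩
    X ^ suc m + suc m * X ^ m                       ≤⟨ bernoulli X m ⟩
    suc X ^ suc m                                   ≡⟨ cong (_^ suc m) (+-suc (suc N) m) ⟨
    (suc N + suc m) ^ suc m                         ∎
    where
    open ≤-Reasoning
    X = suc N + m
    a = length (bounded-vectors m (suc N))
    b = length (bounded-vectors (suc m) N)
    count : length (bounded-vectors (suc m) (suc N)) ≡ a + b
    count = trans (length-++ (map (0 ∷_) (bounded-vectors m (suc N))))
                  (cong₂ _+_ (length-map _ (bounded-vectors m (suc N))) (length-map _ (bounded-vectors (suc m) N)))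
    split : ∀ a b s f → (a + b) * (s * f) ≡ s * (a * f) + b * (s * f)
    split = solve-∀

  -- Markov's inequality for a list: every element with g > K contributes at least c ≤ K + 1 to
  -- the sum of g, so c (|xs| - #{g ≤ K}) ≤ Σ g.
  markov : ∀ {A : Set} (g : A → ℕ) K c → c ≤ suc K → (xs : List A) →
    c * length xs ≤ c * length (filter (λ x → g x ≤? K) xs) + sum (map g xs)
  markov g K c c≤1+K [] = ≤-reflexive (sym (+-identityʳ (c * 0)))
  markov g K c c≤1+K (x ∷ xs) with g x ≤? K
  ... | yes gx≤K rewrite filter-accept (λ x → g x ≤? K) {xs = xs} gx≤K = begin
    c * suc (length xs)                  ≡⟨ *-suc c (length xs) ⟩
    c + c * length xs                    ≤⟨ +-monoʳ-≤ c (markov g K c c≤1+K xs) ⟩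
    c + (c * G + sum (map g xs))         ≡⟨ +-assoc c (c * G) _ ⟨
    c + c * G + sum (map g xs)           ≡⟨ cong (_+ sum (map g xs)) (*-suc c G) ⟨
    c * suc G + sum (map g xs)           ≤⟨ +-monoʳ-≤ (c * suc G) (m≤n+m _ (g x)) ⟩
    c * suc G + (g x + sum (map g xs))   ∎
    where
    open ≤-Reasoning
    G = length (filter (λ x → g x ≤? K) xs)
  ... | no gx≰K rewrite filter-reject (λ x → g x ≤? K) {xs = xs} gx≰K = begin
    c * suc (length xs)                  ≡⟨ *-suc c (length xs) ⟩
    c + c * length xs                    ≤⟨ +-mono-≤ (≤-trans c≤1+K (≰⇒> gx≰K)) (markov g K c c≤1+K xs) ⟩
    g x + (c * G + sum (map g xs))       ≡⟨ rotate (g x) (c * G) (sum (map g xs)) ⟩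
    c * G + (g x + sum (map g xs))       ∎
    where
    open ≤-Reasoning
    G = length (filter (λ x → g x ≤? K) xs)
    rotate : ∀ a b c → a + (b + c) ≡ b + (a + c)
    rotate = solve-∀


module SubsetSums where

  open import Data.Nat hiding (_≟_)
  open import Data.Nat.Properties hiding (_≟_)
  open import Data.Nat.ListAction using (sum)
  open import Data.Nat.ListAction.Properties using (sum-++)
  import Data.Nat.Tactic.RingSolver as ℕ-Solver
  open import Data.Integer as ℤ using (ℤ; +_; -[1+_]; ∣_∣)
  import Data.Integer.Properties as ℤP
  import Data.Integer.Tactic.RingSolver as ℤ-Solver
  open import Data.Fin using (Fin; zero; suc)
  open import Data.List using (List; []; _∷_; map; _++_; length)
  open import Data.List.Properties using (length-map; length-++; map-++; map-∘; map-cong)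
  open import Data.List.Relation.Unary.All as All using (All)
  import Data.List.Relation.Unary.All.Properties as All
  open import Data.List.Relation.Unary.AllPairs as AllPairs using (AllPairs; []; _∷_)
  import Data.List.Relation.Unary.AllPairs.Properties as AllPairsP
  open import Data.Rational using (ℚ; 0ℚ)
  open import Data.Rational.Properties using (_≟_)
  open import Data.Product using (∃; _×_; _,_)
  open import Data.Sum using (_⊎_; inj₁; inj₂)
  open import Relation.Nullary using (¬_; yes; no)
  open import Relation.Binary.PropositionalEquality
  open IntegralVertices using (_·_)
  open NatEstimates using (ΣN; ΣN-cong; ΣN-+; ΣN-*; ΣN-const; ΣN-mono)

  cons : ∀ {n} → ℤ → (Fin n → ℤ) → Fin (suc n) → ℤ
  cons x f zero = x
  cons x f (suc j) = f j

  tail : ∀ {n} → Vect (suc n) → Vect n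
  tail v j = v (suc j)

  drop-column : ∀ {m n} → Matrix m (suc n) → Matrix m n
  drop-column A i j = A i (suc j)

  subset-vectors : ∀ {n} → Vect n → List (Fin n → ℤ)
  subset-vectors {zero} v = (λ ()) ∷ []
  subset-vectors {suc n} v with v zero ≟ 0ℚ
  ... | yes _ = map (cons (+ 0)) (subset-vectors (tail v))
  ... | no _ = map (cons (+ 1)) (subset-vectors (tail v)) ++ map (cons (+ 0)) (subset-vectors (tail v))

  indicator : ∀ {n} → Vect n → Fin n → ℤ
  indicator {zero} v = λ ()
  indicator {suc n} v with v zero ≟ 0ℚ
  ... | yes _ = cons (+ 0) (indicator (tail v))
  ... | no _ = cons (+ 1) (indicator (tail v))

  length-subset-vectors : ∀ {n} (v : Vect n) → length (subset-vectors v) ≡ 2 ^ suppSize v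
  length-subset-vectors {zero} v = refl
  length-subset-vectors {suc n} v with v zero ≟ 0ℚ
  ... | yes _ = trans (length-map _ (subset-vectors (tail v))) (length-subset-vectors (tail v))
  ... | no _ = begin
    length (map (cons (+ 1)) δs ++ map (cons (+ 0)) δs)          ≡⟨ length-++ (map (cons (+ 1)) δs) ⟩
    length (map (cons (+ 1)) δs) + length (map (cons (+ 0)) δs)   ≡⟨ cong₂ _+_ (length-map _ δs) (length-map _ δs) ⟩
    length δs + length δs                                         ≡⟨ cong₂ _+_ IH IH ⟩
    p + p                                                         ≡⟨ cong (λ x → p + x) (+-identityʳ p) ⟨
    2 * p                                                         ∎
    where
    open ≡-Reasoning
    p = 2 ^ suppSize (tail v)
    δs = subset-vectors (tail v)
    IH = length-subset-vectors (tail v)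

  SubsetCoordinate : ℚ → ℤ → Set
  SubsetCoordinate q x = (q ≡ 0ℚ × x ≡ + 0) ⊎ (¬ q ≡ 0ℚ × (x ≡ + 1 ⊎ x ≡ + 0))

  IsSubsetVector : ∀ {n} → Vect n → (Fin n → ℤ) → Set
  IsSubsetVector v δ = ∀ j → SubsetCoordinate (v j) (δ j)

  Distinct : ∀ {n} → (Fin n → ℤ) → (Fin n → ℤ) → Set
  Distinct δ δ′ = ∃ λ j → δ j ≢ δ′ j

  SubsetPair : ∀ {n} → Vect n → (Fin n → ℤ) → (Fin n → ℤ) → Set
  SubsetPair v δ δ′ = IsSubsetVector v δ × IsSubsetVector v δ′ × Distinct δ δ′

  extend : ∀ {n} {v : Vect (suc n)} {x δ} → SubsetCoordinate (v zero) x → IsSubsetVector (tail v) δ →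
    IsSubsetVector v (cons x δ)
  extend first rest zero = first
  extend first rest (suc j) = rest j

  all-subset-vectors : ∀ {n} (v : Vect n) → All (IsSubsetVector v) (subset-vectors v)
  all-subset-vectors {zero} v = (λ ()) All.∷ All.[]
  all-subset-vectors {suc n} v with v zero ≟ 0ℚ
  ... | yes v₀≡0 = All.map⁺ (All.map (extend (inj₁ (v₀≡0 , refl))) (all-subset-vectors (tail v)))
  ... | no v₀≢0 = All.++⁺ (All.map⁺ (All.map (extend (inj₂ (v₀≢0 , inj₁ refl))) (all-subset-vectors (tail v))))
                          (All.map⁺ (All.map (extend (inj₂ (v₀≢0 , inj₂ refl))) (all-subset-vectors (tail v))))

  shift : ∀ {n x y} {δ δ′ : Fin n → ℤ} → Distinct δ δ′ → Distinct (cons x δ) (cons y δ′)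
  shift (j , δⱼ≢δ′ⱼ) = suc j , δⱼ≢δ′ⱼ

  distinct-subset-vectors : ∀ {n} (v : Vect n) → AllPairs Distinct (subset-vectors v)
  distinct-subset-vectors {zero} v = All.[] ∷ []
  distinct-subset-vectors {suc n} v with v zero ≟ 0ℚ
  ... | yes _ = AllPairsP.map⁺ (AllPairs.map shift (distinct-subset-vectors (tail v)))
  ... | no _ = AllPairsP.++⁺ (AllPairsP.map⁺ (AllPairs.map shift (distinct-subset-vectors (tail v))))
                            (AllPairsP.map⁺ (AllPairs.map shift (distinct-subset-vectors (tail v))))
                            (All.map⁺ (All.universal (λ _ → All.map⁺ (All.universal (λ _ → zero , λ ())  _)) _))

  allPairs-with : ∀ {A : Set} {P : A → Set} {R : A → A → Set} {xs} → All P xs → AllPairs R xs →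
    AllPairs (λ x y → P x × P y × R x y) xs
  allPairs-with All.[] [] = []
  allPairs-with (px All.∷ pxs) (rx ∷ rxs) =
    All.zipWith (λ (py , r) → px , py , r) (pxs , rx) ∷ allPairs-with pxs rxs

  subset-pairs : ∀ {n} (v : Vect n) → AllPairs (SubsetPair v) (subset-vectors v)
  subset-pairs v = allPairs-with (all-subset-vectors v) (distinct-subset-vectors v)

  sq : ℤ → ℕ
  sq z = ∣ z ∣ * ∣ z ∣

  norm² : ∀ {m} → (Fin m → ℤ) → ℕ
  norm² u = ΣN (λ i → sq (u i))

  -- A (2δ - c); for c = 1_S this is the image w(δ) of the sign vector 2δ - 1_S ∈ {±1}^S.
  signed-image : ∀ {m n} → Matrix m n → (Fin n → ℤ) → (Fin n → ℤ) → Fin m → ℤ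
  signed-image A c δ i = + 2 ℤ.* (A i · δ) ℤ.- A i · c

  column-energy : ∀ {m n} → Matrix m n → Vect n → ℕ
  column-energy {n = zero} A v = 0
  column-energy {n = suc n} A v with v zero ≟ 0ℚ
  ... | yes _ = column-energy (drop-column A) (tail v)
  ... | no _ = norm² (λ i → A i zero) + column-energy (drop-column A) (tail v)

  sq-as-product : ∀ z → + sq z ≡ z ℤ.* z
  sq-as-product (+ n) = ℤP.pos-* n n
  sq-as-product -[1+ n ] = ℤP.pos-* (suc n) (suc n)

  parallelogram : ∀ x y → sq (x ℤ.+ y) + sq (x ℤ.- y) ≡ 2 * sq x + 2 * sq y
  parallelogram x y = ℤP.+-injective (begin
    + (sq (x ℤ.+ y) + sq (x ℤ.- y))                   ≡⟨ ℤP.pos-+ (sq (x ℤ.+ y)) _ ⟩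
    + sq (x ℤ.+ y) ℤ.+ + sq (x ℤ.- y)                 ≡⟨ cong₂ ℤ._+_ (sq-as-product (x ℤ.+ y)) (sq-as-product (x ℤ.- y)) ⟩
    (x ℤ.+ y) ℤ.* (x ℤ.+ y) ℤ.+ (x ℤ.- y) ℤ.* (x ℤ.- y) ≡⟨ law x y ⟩
    + 2 ℤ.* (x ℤ.* x) ℤ.+ + 2 ℤ.* (y ℤ.* y)           ≡⟨ cong₂ (λ a b → + 2 ℤ.* a ℤ.+ + 2 ℤ.* b) (sq-as-product x) (sq-as-product y) ⟨
    + 2 ℤ.* + sq x ℤ.+ + 2 ℤ.* + sq y                 ≡⟨ cong₂ ℤ._+_ (ℤP.pos-* 2 (sq x)) (ℤP.pos-* 2 (sq y)) ⟨
    + (2 * sq x) ℤ.+ + (2 * sq y)                     ≡⟨ ℤP.pos-+ (2 * sq x) (2 * sq y) ⟨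
    + (2 * sq x + 2 * sq y)                           ∎)
    where
    open ≡-Reasoning
    law : ∀ x y → (x ℤ.+ y) ℤ.* (x ℤ.+ y) ℤ.+ (x ℤ.- y) ℤ.* (x ℤ.- y) ≡ + 2 ℤ.* (x ℤ.* x) ℤ.+ + 2 ℤ.* (y ℤ.* y)
    law = ℤ-Solver.solve-∀

  norm²-parallelogram : ∀ {m} (u a : Fin m → ℤ) →
    norm² (λ i → u i ℤ.+ a i) + norm² (λ i → u i ℤ.- a i) ≡ 2 * norm² u + 2 * norm² a
  norm²-parallelogram u a = begin
    norm² (λ i → u i ℤ.+ a i) + norm² (λ i → u i ℤ.- a i)   ≡⟨ ΣN-+ (λ i → sq (u i ℤ.+ a i)) _ ⟨
    ΣN (λ i → sq (u i ℤ.+ a i) + sq (u i ℤ.- a i))          ≡⟨ ΣN-cong (λ i → parallelogram (u i) (a i)) ⟩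
    ΣN (λ i → 2 * sq (u i) + 2 * sq (a i))                  ≡⟨ ΣN-+ (λ i → 2 * sq (u i)) _ ⟩
    ΣN (λ i → 2 * sq (u i)) + ΣN (λ i → 2 * sq (a i))       ≡⟨ cong₂ _+_ (ΣN-* 2 (λ i → sq (u i))) (ΣN-* 2 (λ i → sq (a i))) ⟩
    2 * norm² u + 2 * norm² a                               ∎
    where open ≡-Reasoning

  sum-map-map : ∀ {X Y : Set} (f : Y → ℕ) (h : X → Y) {g : X → ℕ} (xs : List X) →
    (∀ x → f (h x) ≡ g x) → sum (map f (map h xs)) ≡ sum (map g xs)
  sum-map-map f h xs f∘h≗g = trans (cong sum (sym (map-∘ xs))) (cong sum (map-cong f∘h≗g xs))

  -- Induction on the first coordinate: if it lies in S, the sum splits by δ₀ ∈ {1, 0} into the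
  -- sums for the remaining coordinates with u shifted by ±A₀, and the parallelogram law applies.
  second-moment : ∀ {m n} (A : Matrix m n) (v : Vect n) (u : Fin m → ℤ) →
    sum (map (λ δ → norm² (λ i → u i ℤ.+ signed-image A (indicator v) δ i)) (subset-vectors v))
      ≡ 2 ^ suppSize v * (norm² u + column-energy A v)
  second-moment {n = zero} A v u = begin
    norm² (λ i → u i ℤ.+ + 0) + 0   ≡⟨ cong (_+ 0) (ΣN-cong (λ i → cong sq (ℤP.+-identityʳ (u i)))) ⟩
    norm² u + 0                     ≡⟨ *-identityˡ _ ⟨
    1 * (norm² u + 0)               ∎
    where open ≡-Reasoning
  second-moment {m} {suc n} A v u with v zero ≟ 0ℚ
  ... | yes _ = begin
    sum (map (energy u) (map (cons (+ 0)) δs))   ≡⟨ sum-map-map (energy u) (cons (+ 0)) δs (λ δ → ΣN-cong (λ i → cong sq (unchanged (u i) (A i zero) _ _))) ⟩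
    sum (map (energy′ u) δs)                     ≡⟨ second-moment A′ (tail v) u ⟩
    2 ^ suppSize (tail v) * (norm² u + column-energy A′ (tail v)) ∎
    where
    open ≡-Reasoning
    A′ = drop-column A
    δs = subset-vectors (tail v)
    energy energy′ : (Fin m → ℤ) → _ → ℕ
    energy w δ = norm² (λ i → w i ℤ.+ signed-image A (cons (+ 0) (indicator (tail v))) δ i)
    energy′ w δ = norm² (λ i → w i ℤ.+ signed-image A′ (indicator (tail v)) δ i)
    unchanged : ∀ u a x y → u ℤ.+ (+ 2 ℤ.* (a ℤ.* + 0 ℤ.+ x) ℤ.- (a ℤ.* + 0 ℤ.+ y)) ≡ u ℤ.+ (+ 2 ℤ.* x ℤ.- y)
    unchanged = ℤ-Solver.solve-∀
  ... | no _ = begin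
    sum (map (energy u) (map (cons (+ 1)) δs ++ map (cons (+ 0)) δs))
      ≡⟨ cong sum (map-++ (energy u) (map (cons (+ 1)) δs) _) ⟩
    sum (map (energy u) (map (cons (+ 1)) δs) ++ map (energy u) (map (cons (+ 0)) δs))
      ≡⟨ sum-++ (map (energy u) (map (cons (+ 1)) δs)) _ ⟩
    sum (map (energy u) (map (cons (+ 1)) δs)) + sum (map (energy u) (map (cons (+ 0)) δs))
      ≡⟨ cong₂ _+_ (sum-map-map (energy u) (cons (+ 1)) δs (λ δ → ΣN-cong (λ i → cong sq (shift-up (u i) (A i zero) _ _))))
                   (sum-map-map (energy u) (cons (+ 0)) δs (λ δ → ΣN-cong (λ i → cong sq (shift-down (u i) (A i zero) _ _)))) ⟩
    sum (map (energy′ u₊) δs) + sum (map (energy′ u₋) δs)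
      ≡⟨ cong₂ _+_ (second-moment A′ (tail v) u₊) (second-moment A′ (tail v) u₋) ⟩
    p * (norm² u₊ + Q) + p * (norm² u₋ + Q)
      ≡⟨ collect p (norm² u₊) (norm² u₋) Q ⟩
    p * ((norm² u₊ + norm² u₋) + 2 * Q)
      ≡⟨ cong (λ x → p * (x + 2 * Q)) (norm²-parallelogram u a) ⟩
    p * ((2 * norm² u + 2 * norm² a) + 2 * Q)
      ≡⟨ factor p (norm² u) (norm² a) Q ⟩
    2 * p * (norm² u + (norm² a + Q))          ∎
    where
    open ≡-Reasoning
    A′ = drop-column A
    δs = subset-vectors (tail v)
    p = 2 ^ suppSize (tail v)
    Q = column-energy A′ (tail v)
    a u₊ u₋ : Fin m → ℤ
    a i = A i zero
    u₊ i = u i ℤ.+ a i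
    u₋ i = u i ℤ.- a i
    energy energy′ : (Fin m → ℤ) → _ → ℕ
    energy w δ = norm² (λ i → w i ℤ.+ signed-image A (cons (+ 1) (indicator (tail v))) δ i)
    energy′ w δ = norm² (λ i → w i ℤ.+ signed-image A′ (indicator (tail v)) δ i)
    shift-up : ∀ u a x y → u ℤ.+ (+ 2 ℤ.* (a ℤ.* + 1 ℤ.+ x) ℤ.- (a ℤ.* + 1 ℤ.+ y)) ≡ (u ℤ.+ a) ℤ.+ (+ 2 ℤ.* x ℤ.- y)
    shift-up = ℤ-Solver.solve-∀
    shift-down : ∀ u a x y → u ℤ.+ (+ 2 ℤ.* (a ℤ.* + 0 ℤ.+ x) ℤ.- (a ℤ.* + 1 ℤ.+ y)) ≡ (u ℤ.- a) ℤ.+ (+ 2 ℤ.* x ℤ.- y)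
    shift-down = ℤ-Solver.solve-∀
    collect : ∀ p x y Q → p * (x + Q) + p * (y + Q) ≡ p * ((x + y) + 2 * Q)
    collect = ℕ-Solver.solve-∀
    factor : ∀ p U W Q → p * ((2 * U + 2 * W) + 2 * Q) ≡ 2 * p * (U + (W + Q))
    factor = ℕ-Solver.solve-∀

  column-energy≤ : ∀ {m n} (A : Matrix m n) (v : Vect n) D → (∀ i j → ∣ A i j ∣ ≤ D) →
    column-energy A v ≤ suppSize v * (m * (D * D))
  column-energy≤ {n = zero} A v D _ = z≤n
  column-energy≤ {m} {suc n} A v D |A|≤D with v zero ≟ 0ℚ
  ... | yes _ = column-energy≤ (drop-column A) (tail v) D (λ i j → |A|≤D i (suc j))
  ... | no _ = +-mono-≤ column≤ (column-energy≤ (drop-column A) (tail v) D (λ i j → |A|≤D i (suc j)))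
    where
    column≤ : norm² (λ i → A i zero) ≤ m * (D * D)
    column≤ = begin
      ΣN (λ i → sq (A i zero))  ≤⟨ ΣN-mono (λ i → *-mono-≤ (|A|≤D i zero) (|A|≤D i zero)) ⟩
      ΣN {m} (λ _ → D * D)      ≡⟨ ΣN-const m (D * D) ⟩
      m * (D * D)               ∎
      where open ≤-Reasoning


module SupportBound where

  open import Data.Nat hiding (_≟_; _/_)
  open import Data.Nat.Properties hiding (_≟_)
  open import Data.Nat.ListAction using (sum)
  import Data.Nat.Tactic.RingSolver as ℕ-Solver
  open import Data.Integer as ℤ using (ℤ; +_; ∣_∣; sign; _◃_; _/ℕ_; _%ℕ_)
  import Data.Integer.Properties as ℤP
  import Data.Integer.DivMod as ℤDivMod
  import Data.Integer.Tactic.RingSolver as ℤ-Solver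
  open import Data.Sign using (Sign)
  open import Data.Fin using (Fin; zero; suc)
  open import Data.Vec as Vec using (Vec; tabulate)
  import Data.Vec.Properties as Vec
  open import Data.List using (List; []; _∷_; map; length; filter; cartesianProduct)
  open import Data.List.Properties using (length-map; map-cong)
  open import Data.List.Membership.Propositional using (_∈_)
  open import Data.List.Membership.Propositional.Properties using (∈-map⁻; ∈-filter⁻; ∈-cartesianProduct⁺)
  open import Data.List.Relation.Unary.Any using (here; there)
  open import Data.List.Relation.Unary.AllPairs as AllPairs using (AllPairs)
  import Data.List.Relation.Unary.AllPairs.Properties as AllPairsP
  open import Data.Product using (_×_; _,_; proj₁; proj₂)
  open import Data.Sum using (_⊎_; inj₁; inj₂)
  open import Data.Empty using (⊥-elim)
  open import Relation.Binary.PropositionalEquality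
  open IntegralVertices
  open NatEstimates
  open FiniteCounting
  open SubsetSums

  -- With c = A 1_S written as c = 2h + r (r ∈ {0, 1}), the offset Aδ - h of a subset vector
  -- satisfies 2(Aδ - h) = w(δ) + r, so it is small whenever w(δ) is, and determines Aδ.
  module Offsets {m n} (A : Matrix m n) (v : Vect n) where

    centre : Fin m → ℤ
    centre i = A i · indicator v

    offset : (Fin n → ℤ) → Fin m → ℤ
    offset δ i = A i · δ ℤ.- centre i /ℕ 2

    offset-double : ∀ δ i → + 2 ℤ.* offset δ i ≡ signed-image A (indicator v) δ i ℤ.+ + (centre i %ℕ 2)
    offset-double δ i = begin
      + 2 ℤ.* (A i · δ ℤ.- h)                             ≡⟨ rearrange (A i · δ) h r ⟩
      (+ 2 ℤ.* A i · δ ℤ.- (r ℤ.+ h ℤ.* + 2)) ℤ.+ r       ≡⟨ cong (λ c → (+ 2 ℤ.* A i · δ ℤ.- c) ℤ.+ r) (ℤDivMod.a≡a%ℕn+[a/ℕn]*n (centre i) 2) ⟨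
      signed-image A (indicator v) δ i ℤ.+ r               ∎
      where
      open ≡-Reasoning
      h = centre i /ℕ 2
      r = + (centre i %ℕ 2)
      rearrange : ∀ a h r → + 2 ℤ.* (a ℤ.- h) ≡ (+ 2 ℤ.* a ℤ.- (r ℤ.+ h ℤ.* + 2)) ℤ.+ r
      rearrange = ℤ-Solver.solve-∀

    offset-bound : ∀ δ i → ∣ offset δ i ∣ + ∣ offset δ i ∣ ≤ ∣ signed-image A (indicator v) δ i ∣ + 1
    offset-bound δ i = begin
      ∣ offset δ i ∣ + ∣ offset δ i ∣         ≡⟨ cong (λ x → ∣ offset δ i ∣ + x) (+-identityʳ _) ⟨
      2 * ∣ offset δ i ∣                      ≡⟨ ℤP.∣i*j∣≡∣i∣*∣j∣ (+ 2) (offset δ i) ⟨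
      ∣ + 2 ℤ.* offset δ i ∣                  ≡⟨ cong ∣_∣ (offset-double δ i) ⟩
      ∣ w ℤ.+ + (centre i %ℕ 2) ∣             ≤⟨ ℤP.∣i+j∣≤∣i∣+∣j∣ w (+ (centre i %ℕ 2)) ⟩
      ∣ w ∣ + centre i %ℕ 2                   ≤⟨ +-monoʳ-≤ ∣ w ∣ (≤-pred (ℤDivMod.n%ℕd<d (centre i) 2)) ⟩
      ∣ w ∣ + 1                               ∎
      where
      open ≤-Reasoning
      w = signed-image A (indicator v) δ i

    Code : Set
    Code = Vec ℕ m × Vec Sign m

    code : (Fin n → ℤ) → Code
    code δ = tabulate (λ i → ∣ offset δ i ∣) , tabulate (λ i → sign (offset δ i))

    code-injective : ∀ δ δ′ → code δ ≡ code δ′ → ∀ i → A i · δ ≡ A i · δ′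
    code-injective δ δ′ same i = begin
      A i · δ                          ≡⟨ restore (A i · δ) ⟨
      offset δ i ℤ.+ centre i /ℕ 2     ≡⟨ cong (ℤ._+ centre i /ℕ 2) same-offset ⟩
      offset δ′ i ℤ.+ centre i /ℕ 2    ≡⟨ restore (A i · δ′) ⟩
      A i · δ′                         ∎
      where
      open ≡-Reasoning
      entry : ∀ {X : Set} (f f′ : Fin m → X) → tabulate f ≡ tabulate f′ → f i ≡ f′ i
      entry f f′ e = trans (sym (Vec.lookup∘tabulate f i))
                           (trans (cong (λ t → Vec.lookup t i) e) (Vec.lookup∘tabulate f′ i))
      same-offset : offset δ i ≡ offset δ′ i
      same-offset = begin
        offset δ i                                       ≡⟨ ℤP.◃-inverse (offset δ i) ⟨
        sign (offset δ i) ◃ ∣ offset δ i ∣               ≡⟨ cong₂ _◃_ (entry _ _ (cong proj₂ same)) (entry _ _ (cong proj₁ same)) ⟩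
        sign (offset δ′ i) ◃ ∣ offset δ′ i ∣             ≡⟨ ℤP.◃-inverse (offset δ′ i) ⟩
        offset δ′ i                                      ∎
      restore : ∀ a → (a ℤ.- centre i /ℕ 2) ℤ.+ centre i /ℕ 2 ≡ a
      restore a = identity a (centre i /ℕ 2)
        where
        identity : ∀ a h → (a ℤ.- h) ℤ.+ h ≡ a
        identity = ℤ-Solver.solve-∀

    -- If ‖w(δ)‖² ≤ K then, by Cauchy–Schwarz, ‖w(δ)‖₁ ≤ ⌊√(mK)⌋ and so ‖Aδ - h‖₁ ≤ ⌊(⌊√(mK)⌋ + m)/2⌋.
    offset-ℓ₁-bound : ∀ K δ → norm² (signed-image A (indicator v) δ) ≤ K →
      ΣN (λ i → ∣ offset δ i ∣) ≤ ⌊ isqrt (m * K) + m /2⌋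
    offset-ℓ₁-bound K δ ‖w‖²≤K = x+x≤a⇒x≤⌊a/2⌋ (begin
      ΣN |off| + ΣN |off|            ≡⟨ ΣN-+ |off| |off| ⟨
      ΣN (λ i → |off| i + |off| i)   ≤⟨ ΣN-mono (offset-bound δ) ⟩
      ΣN (λ i → |w| i + 1)           ≡⟨ ΣN-+ |w| (λ _ → 1) ⟩
      ΣN |w| + ΣN {m} (λ _ → 1)      ≤⟨ +-mono-≤ ‖w‖₁≤ (≤-reflexive (trans (ΣN-const m 1) (*-identityʳ m))) ⟩
      isqrt (m * K) + m              ∎)
      where
      open ≤-Reasoning
      |off| |w| : Fin m → ℕ
      |off| i = ∣ offset δ i ∣
      |w| i = ∣ signed-image A (indicator v) δ i ∣
      ‖w‖₁≤ : ΣN |w| ≤ isqrt (m * K)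
      ‖w‖₁≤ = isqrt-maximal (m * K) (ΣN |w|) (≤-trans (cauchy-schwarz |w|) (*-monoʳ-≤ m ‖w‖²≤K))
      x+x≤a⇒x≤⌊a/2⌋ : ∀ {x a} → x + x ≤ a → x ≤ ⌊ a /2⌋
      x+x≤a⇒x≤⌊a/2⌋ {x} x+x≤a = subst (_≤ _) (sym (n≡⌊n+n/2⌋ x)) (⌊n/2⌋-mono x+x≤a)

    codes : ℕ → List Code
    codes N = cartesianProduct (bounded-vectors m N) (vectors-over (Sign.+ ∷ Sign.- ∷ []) m)

    length-codes : ∀ N → length (codes N) ≡ length (bounded-vectors m N) * 2 ^ m
    length-codes N = trans (length-cartesianProductWith _,_ (bounded-vectors m N) _)
                           (cong (length (bounded-vectors m N) *_) (length-vectors-over (Sign.+ ∷ Sign.- ∷ []) m))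

    code∈codes : ∀ N δ → ΣN (λ i → ∣ offset δ i ∣) ≤ N → code δ ∈ codes N
    code∈codes N δ ‖offset‖₁≤N = ∈-cartesianProduct⁺
      (∈-bounded-vectors N _ (subst (_≤ N) (sym (vec-sum-tabulate (λ i → ∣ offset δ i ∣))) ‖offset‖₁≤N))
      (∈-vectors-over _ every-sign)
      where
      every-sign : ∀ σ → σ ∈ Sign.+ ∷ Sign.- ∷ []
      every-sign Sign.+ = here refl
      every-sign Sign.- = there (here refl)
      vec-sum-tabulate : ∀ {k} (f : Fin k → ℕ) → vec-sum (tabulate f) ≡ ΣN f
      vec-sum-tabulate {zero} f = refl
      vec-sum-tabulate {suc k} f = cong (λ x → f zero + x) (vec-sum-tabulate (λ i → f (suc i)))

  difference-balanced : ∀ {q W x y} → q ≡ ι W → + 0 ℤ.≤ W →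
    SubsetCoordinate q x → SubsetCoordinate q y → Balanced W (x ℤ.- y)
  difference-balanced _ _ (inj₁ (_ , refl)) (inj₁ (_ , refl)) = inj₁ refl
  difference-balanced _ _ (inj₁ (q≡0 , _)) (inj₂ (q≢0 , _)) = ⊥-elim (q≢0 q≡0)
  difference-balanced _ _ (inj₂ (q≢0 , _)) (inj₁ (q≡0 , _)) = ⊥-elim (q≢0 q≡0)
  difference-balanced {W = + zero} q≡0 _ (inj₂ (q≢0 , _)) _ = ⊥-elim (q≢0 q≡0)
  difference-balanced {W = + suc _} _ _ (inj₂ (_ , x≡1∨0)) (inj₂ (_ , y≡1∨0)) = steps x≡1∨0 y≡1∨0
    where
    W≥1 = ℤ.+≤+ (s≤s z≤n)
    steps : ∀ {x y} → x ≡ + 1 ⊎ x ≡ + 0 → y ≡ + 1 ⊎ y ≡ + 0 → Balanced (+ suc _) (x ℤ.- y)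
    steps (inj₁ refl) (inj₁ refl) = inj₁ refl
    steps (inj₁ refl) (inj₂ refl) = inj₂ (W≥1 , inj₁ refl)
    steps (inj₂ refl) (inj₁ refl) = inj₂ (W≥1 , inj₂ refl)
    steps (inj₂ refl) (inj₂ refl) = inj₁ refl

  module AtVertex {m n} (A : Matrix m n) b v (vertex : IsVertex A b v) where
    open Offsets A v

    -- Distinct subset vectors have distinct codes: otherwise Z = δ - δ′ is a nonzero balanced
    -- vector with A Z = 0 (code-injective), which a vertex does not admit.
    distinct-codes : ∀ {δ δ′} → SubsetPair v δ δ′ → code δ ≢ code δ′
    distinct-codes {δ} {δ′} (δ-subset , δ′-subset , j₀ , δⱼ₀≢δ′ⱼ₀) same-code =
      no-balanced-kernel-vector A b v vertex point Z balanced j₀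
        (λ Zⱼ₀≡0 → δⱼ₀≢δ′ⱼ₀ (ℤP.i-j≡0⇒i≡j (δ j₀) (δ′ j₀) Zⱼ₀≡0)) AZ≡0
      where
      point = vertex-integral A b v vertex
      V = proj₁ point
      Z : Fin n → ℤ
      Z j = δ j ℤ.- δ′ j
      balanced : ∀ j → Balanced (V j) (Z j)
      balanced j = difference-balanced (proj₁ (proj₂ point) j) (proj₁ (proj₂ (proj₂ point)) j)
                     (δ-subset j) (δ′-subset j)
      AZ≡0 : ∀ i → A i · Z ≡ + 0
      AZ≡0 i = begin
        A i · Z                           ≡⟨ ·-+ʳ (A i) δ (λ j → ℤ.- δ′ j) ⟩
        A i · δ ℤ.+ A i · (λ j → ℤ.- δ′ j) ≡⟨ cong (λ x → A i · δ ℤ.+ x) (·-negʳ (A i) δ′) ⟩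
        A i · δ ℤ.- A i · δ′              ≡⟨ ℤP.i≡j⇒i-j≡0 (code-injective δ δ′ same-code i) ⟩
        + 0                               ∎
        where open ≡-Reasoning

    few-small-images : ∀ K → let g = λ δ → norm² (signed-image A (indicator v) δ) in
      length (filter (λ δ → g δ ≤? K) (subset-vectors v)) ≤ length (codes ⌊ isqrt (m * K) + m /2⌋)
    few-small-images K = subst (_≤ length (codes N)) (length-map code small)
      (distinct-length≤ (map code small) (codes N) distinct code∈)
      where
      g = λ δ → norm² (signed-image A (indicator v) δ)
      small = filter (λ δ → g δ ≤? K) (subset-vectors v)
      N = ⌊ isqrt (m * K) + m /2⌋
      distinct : AllPairs _≢_ (map code small)
      distinct = AllPairsP.map⁺ (AllPairs.map distinct-codes (AllPairsP.filter⁺ (λ δ → g δ ≤? K) (subset-pairs v)))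
      code∈ : ∀ {c} → c ∈ map code small → c ∈ codes N
      code∈ c∈ with ∈-map⁻ code c∈
      ... | δ , δ∈ , refl = code∈codes N δ (offset-ℓ₁-bound K δ (proj₂ (∈-filter⁻ (λ δ → g δ ≤? K) {xs = subset-vectors v} δ∈)))

  -- Markov's inequality and the second moment: the average of ‖w(δ)‖² over the 2^s subset vectors is
  -- Σ_{j ∈ S} ‖Aⱼ‖² ≤ B = m s D², so at least two thirds of them have ‖w(δ)‖² ≤ 3B.
  many-small-images : ∀ {m n} (A : Matrix m n) v D → (∀ i j → ∣ A i j ∣ ≤ D) →
    let B = m * (suppSize v * (D * D)) ; g = λ δ → norm² (signed-image A (indicator v) δ) in
    1 ≤ B → 2 * 2 ^ suppSize v ≤ 3 * length (filter (λ δ → g δ ≤? 3 * B) (subset-vectors v))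
  many-small-images {m} A v D |A|≤D B≥1 = +-cancelʳ-≤ L (2 * L) (3 * G) (*-cancelˡ-≤ B {{>-nonZero B≥1}} (begin
    B * (2 * L + L)                 ≡⟨ triple B L ⟩
    3 * B * L                       ≡⟨ cong (3 * B *_) (length-subset-vectors v) ⟨
    3 * B * length δs               ≤⟨ markov g (3 * B) (3 * B) (n≤1+n _) δs ⟩
    3 * B * G + sum (map g δs)      ≤⟨ +-monoʳ-≤ (3 * B * G) moment≤ ⟩
    3 * B * G + B * L               ≡⟨ factor B G L ⟩
    B * (3 * G + L)                 ∎))
    where
    open ≤-Reasoning
    s = suppSize v
    L = 2 ^ s
    B = m * (s * (D * D))
    δs = subset-vectors v
    g = λ δ → norm² (signed-image A (indicator v) δ)
    G = length (filter (λ δ → g δ ≤? 3 * B) δs)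
    triple : ∀ B L → B * (2 * L + L) ≡ 3 * B * L
    triple = ℕ-Solver.solve-∀
    factor : ∀ B G L → 3 * B * G + B * L ≡ B * (3 * G + L)
    factor = ℕ-Solver.solve-∀
    swap : ∀ s m d → s * (m * d) ≡ m * (s * d)
    swap = ℕ-Solver.solve-∀
    moment≤ : sum (map g δs) ≤ B * L
    moment≤ = begin
      sum (map g δs)                             ≡⟨ cong sum (map-cong (λ δ → ΣN-cong {m} (λ i → cong sq (ℤP.+-identityˡ (signed-image A (indicator v) δ i)))) δs) ⟨
      sum (map (λ δ → norm² (λ i → + 0 ℤ.+ signed-image A (indicator v) δ i)) δs)
                                                 ≡⟨ second-moment A v (λ _ → + 0) ⟩
      L * (norm² {m} (λ _ → + 0) + column-energy A v) ≡⟨ cong (λ x → L * (x + column-energy A v)) (ΣN-const m 0) ⟩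
      L * (m * 0 + column-energy A v)            ≡⟨ cong (λ x → L * (x + column-energy A v)) (*-zeroʳ m) ⟩
      L * column-energy A v                      ≤⟨ *-monoʳ-≤ L (column-energy≤ A v D |A|≤D) ⟩
      L * (s * (m * (D * D)))                    ≡⟨ cong (L *_) (swap s m (D * D)) ⟩
      L * B                                      ≡⟨ *-comm L B ⟩
      B * L                                      ∎

  -- The main estimate for m = k + 1 ≥ 1 and s ≥ 5: combine the counting bounds
  --   2·2^s ≤ 3 #{δ : ‖w(δ)‖² ≤ 3B} ≤ 3 · C(N + m, m) · 2ᵐ
  -- with the arithmetic of support-arithmetic.
  support-bound : ∀ {k n} (A : Matrix (suc k) n) b v → IsVertex A b v →
    ∀ D → 1 ≤ D → (∀ i j → ∣ A i j ∣ ≤ D) → 5 ≤ suppSize v →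
    2 ^ suppSize v ≤ (576 * suc k * (D * D)) ^ suc k
  support-bound {k} A b v vertex D D≥1 |A|≤D s≥5 =
    support-arithmetic k D s C N r D≥1 s≥5 2^s≤C (length-bounded-vectors m N) N+N≤r+m (isqrt-sound (m * K))
    where
    open Offsets A v using (length-codes)
    open AtVertex A b v vertex using (few-small-images)
    m = suc k
    s = suppSize v
    B = m * (s * (D * D))
    K = 3 * B
    r = isqrt (m * K)
    N = ⌊ r + m /2⌋
    C = length (bounded-vectors m N)
    B≥1 : 1 ≤ B
    B≥1 = *-mono-≤ {1} {m} (s≤s z≤n) (*-mono-≤ (≤-trans (s≤s z≤n) s≥5) (*-mono-≤ D≥1 D≥1))
    2^s≤C : 2 * 2 ^ s ≤ 3 * (C * 2 ^ m)
    2^s≤C = ≤-trans (many-small-images A v D |A|≤D B≥1)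
                    (*-monoʳ-≤ 3 (≤-trans (few-small-images K) (≤-reflexive (length-codes N))))
    N+N≤r+m : N + N ≤ r + m
    N+N≤r+m = ≤-trans (+-monoʳ-≤ N (⌊n/2⌋≤⌈n/2⌉ (r + m))) (≤-reflexive (⌊n/2⌋+⌈n/2⌉≡n (r + m)))


open import Data.Fin using (Fin; zero; suc)
open import Data.Integer using (ℤ; ∣_∣)
open import Data.Nat using (ℕ; _≤_; _^_; _*_; zero; suc; z≤n; s≤s; _<_; _≤?_; >-nonZero)
open import Data.Nat.Properties using (≤-trans; m≤m⊔n; m≤n⊔m; ^-monoʳ-≤; m≤m*n; m≤m+n; *-mono-≤; ≰⇒>; m^n>0)
open import Relation.Nullary using (yes; no)
open SupportBound using (support-bound)

entry≤Δ : ∀ {m n} (A : Matrix m n) i j → ∣ A i j ∣ ≤ Δ A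
entry≤Δ A i j = ≤-trans (≤maxℕ (λ j → ∣ A i j ∣) j) (≤maxℕ (λ i → maxℕ (λ j → ∣ A i j ∣)) i)
  where
  ≤maxℕ : ∀ {k} (f : Fin k → ℕ) i → f i ≤ maxℕ f
  ≤maxℕ f zero = m≤m⊔n (f zero) _
  ≤maxℕ f (suc i) = ≤-trans (≤maxℕ (λ j → f (suc j)) i) (m≤n⊔m (f zero) _)

-- Supports of size s ≤ 4 satisfy the bound trivially: 2^s ≤ 16 ≤ X ≤ X^(k+1).
small-support : ∀ k s X → 16 ≤ X → s < 5 → 2 ^ s ≤ X ^ suc k
small-support k s X 16≤X (s≤s s≤4) =
  ≤-trans (^-monoʳ-≤ 2 s≤4) (≤-trans 16≤X (m≤m*n X (X ^ k) {{>-nonZero (m^n>0 X k)}}))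
  where instance X≢0 = >-nonZero (≤-trans (s≤s z≤n) 16≤X)

-- m = 0 is impossible because then Δ A = 0; supports of size at most 4 are trivial; otherwise
-- the counting argument applies with D = Δ A.
corollary14 : (m n : ℕ) (A : Matrix m n) (b : Fin m → ℤ) (v : Vect n) →
    1 ≤ Δ A → IsVertex A b v →
    2 ^ suppSize v ≤ (576 * m * (Δ A * Δ A)) ^ m
corollary14 zero n A b v () vertex
corollary14 (suc k) n A b v Δ≥1 vertex with 5 ≤? suppSize v
... | yes s≥5 = support-bound A b v vertex (Δ A) Δ≥1 (entry≤Δ A) s≥5
... | no s≱5 = small-support k (suppSize v) _ 16≤X (≰⇒> s≱5)
  where
  16≤X : 16 ≤ 576 * suc k * (Δ A * Δ A)
  16≤X = ≤-trans (m≤m+n 16 560) (*-mono-≤ {576} (m≤m*n 576 (suc k)) (*-mono-≤ Δ≥1 Δ≥1))
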